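{- Let $p$ be an odd prime, $q=p^s$, $n\ge1$, $c\in\mathbb{F}_{q^n}^*$, and let $Q_c(x)=\mathrm{Tr}\big(cx\mathrm{Tr}(x)\big)$, a quadratic form on $\mathbb{F}_{q^n}$ over $\mathbb{F}_q$. Fix an $\mathbb{F}_q$-basis $v_1,\dots,v_n$ of $\mathbb{F}_{q^n}$ and let $H=(h_{ij})$ be the associated matrix of $Q_c$, i.e. $h_{ii}=Q_c(v_i)$ and $h_{ij}=\frac12\big(Q_c(v_i+v_j)-Q_c(v_i)-Q_c(v_j)\big)$ for $i\ne j$. Let $l=\mathrm{rank}(H)$, choose $M\in GL_n(\mathbb{F}_q)$ with $MHM^T=\mathrm{diag}(a_1,\dots,a_l,0,\dots,0)$ where $a_1,\dots,a_l\in\mathbb{F}_q^*$, and set $\delta=a_1\cdots a_l$. Then $$\eta_2(\delta)=\begin{cases}\eta_2(c),&\text{if } c\in\mathbb{F}_q^*;\\ \eta_2(-1),&\text{if } c\in\mathbb{F}_{q^n}\setminus\mathbb{F}_q.\end{cases}$$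
   Context: $\mathrm{Tr}$ denotes the trace map $\mathbb{F}_{q^n}\to\mathbb{F}_q$; $\eta_2$ denotes the quadratic character of $\mathbb{F}_q^*$. The value $\eta_2(\delta)$ does not depend on the choice of basis or of $M$. -}

module Defs where

open import Level using (0ℓ)
open import Data.Nat using (ℕ; zero; suc; _^_)
open import Data.Fin using (Fin; toℕ)
open import Data.Fin.Properties using (any?)
open import Data.Integer using (ℤ; 1ℤ; -1ℤ)
open import Data.Product using (Σ; _×_; _,_; ∃)
open import Relation.Nullary using (¬_; yes; no; _×-dec_)
import Data.Fin
import Data.Fin as Fin
open import Relation.Binary.PropositionalEquality using (_≡_; _≢_)
open import Relation.Binary.Definitions using (DecidableEquality)
open import Algebra.Structures using (IsCommutativeRing)
open import Function.Bundles using (_↔_; Inverse)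

record FieldOfOrder (N : ℕ) : Set₁ where
  infixl 7 _*_
  infixl 6 _+_ _-_
  infix 8 -_
  field
    Carrier : Set
    _+_ _*_ : Carrier → Carrier → Carrier
    -_      : Carrier → Carrier
    0# 1#   : Carrier
    isCommutativeRing : IsCommutativeRing _≡_ _+_ _*_ -_ 0# 1#
    0≢1     : 0# ≢ 1#
    _⁻¹     : Carrier → Carrier
    inverseʳ : ∀ x → x ≢ 0# → x * (x ⁻¹) ≡ 1#
    _≟_     : DecidableEquality Carrier
    enum    : Carrier ↔ Fin N

  _-_ : Carrier → Carrier → Carrier
  x - y = x + (- y)

  pow : Carrier → ℕ → Carrier
  pow x zero    = 1#
  pow x (suc k) = x * pow x k

  Σᶠ : ∀ n → (Fin n → Carrier) → Carrier
  Σᶠ zero    f = 0#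
  Σᶠ (suc n) f = f Fin.zero + Σᶠ n (λ i → f (Fin.suc i))

  Πᶠ : ∀ n → (Fin n → Carrier) → Carrier
  Πᶠ zero    f = 1#
  Πᶠ (suc n) f = f Fin.zero * Πᶠ n (λ i → f (Fin.suc i))

  elem : Fin N → Carrier
  elem = Inverse.from enum

module FieldTheory {q n : ℕ} (L : FieldOfOrder (q ^ n)) where
  open FieldOfOrder L

  -- the subfield F_q = { x ∈ F_{q^n} | x^q = x }
  InK : Carrier → Set
  InK x = pow x q ≡ x

  Tr : Carrier → Carrier
  Tr x = Σᶠ n (λ i → pow x (q ^ toℕ i))

  IsSquareK : Carrier → Set
  IsSquareK x = ∃ λ b → InK b × (b * b ≡ x)

  η₂ : Carrier → ℤ
  η₂ x with any? (λ k → ((pow (elem k) q) ≟ (elem k)) ×-dec ((elem k * elem k) ≟ x))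
  ... | yes _ = 1ℤ
  ... | no  _ = -1ℤ

  Qc : Carrier → Carrier → Carrier
  Qc c x = Tr (c * x * Tr x)

  half : Carrier
  half = (1# + 1#) ⁻¹

  Hmat : Carrier → (Fin n → Carrier) → Fin n → Fin n → Carrier
  Hmat c v i j with i Data.Fin.≟ j
  ... | yes _ = Qc c (v i)
  ... | no  _ = half * (Qc c (v i + v j) - Qc c (v i) - Qc c (v j))

  IsBasis : (Fin n → Carrier) → Set
  IsBasis v =
    (∀ x → ∃ λ (a : Fin n → Carrier) → (∀ i → InK (a i)) × (Σᶠ n (λ i → a i * v i) ≡ x))
    × (∀ (a : Fin n → Carrier) → (∀ i → InK (a i)) → Σᶠ n (λ i → a i * v i) ≡ 0# → ∀ i → a i ≡ 0#)

  Mat : Set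
  Mat = Fin n → Fin n → Carrier

  infixl 7 _·_
  infix 9 _ᵀ
  infix 4 _≐_

  _≐_ : Mat → Mat → Set
  A ≐ B = ∀ i j → A i j ≡ B i j

  _·_ : Mat → Mat → Mat
  (A · B) i j = Σᶠ n (λ k → A i k * B k j)

  _ᵀ : Mat → Mat
  (A ᵀ) i j = A j i

  Id : Mat
  Id i j with i Data.Fin.≟ j
  ... | yes _ = 1#
  ... | no  _ = 0#

  KMat : Mat → Set
  KMat A = ∀ i j → InK (A i j)

  InGL : Mat → Set
  InGL M = KMat M × ∃ λ N → KMat N × (M · N ≐ Id) × (N · M ≐ Id)

  diag : (Fin n → Carrier) → Mat
  diag d i j with i Data.Fin.≟ j
  ... | yes _ = d i
  ... | no  _ = 0#

{-# OPTIONS --safe #-}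
-- Since Tr x ∈ K = F_q and Tr is K-linear, Q_c(x) = Tr(x) Tr(cx).  For the basis wᵢ = Σₖ Mᵢₖ vₖ put
-- tᵢ = Tr(wᵢ) and uᵢ = Tr(c wᵢ); then M H Mᵀ = ½(t uᵀ + u tᵀ), so being diagonal means aᵢ = tᵢuᵢ and
-- tᵢuⱼ + tⱼuᵢ = 0 for i ≢ j.  The trace form is nondegenerate, so t ≢ 0 and u ≢ 0, and u ∈ K t exactly
-- when c ∈ K.  If u = c t, then 2c tᵢtⱼ = 0 leaves one nonzero entry a₁ = c t₁², whence η₂(δ) = η₂(c).
-- Otherwise rank 0 or 1 would force t = 0, u = 0 or u ∈ K t, while three nonzero entries would make
-- P = (t₁u₂)(t₂u₃)(t₃u₁) equal to -P; so the rank is 2 and δ = a₁a₂ = -(t₁u₂)², whence η₂(δ) = η₂(-1).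
module Submission where

open import Defs
open import Data.Nat using (ℕ; _^_; _≤_; _<_)
open import Data.Nat.Primality using (Prime)
open import Data.Fin using (Fin; toℕ; inject≤)
open import Data.Product using (_×_; _,_; proj₁)
open import Relation.Nullary using (¬_)
open import Relation.Binary.PropositionalEquality using (_≡_; _≢_)

open import Data.Nat as ℕ using (zero; suc; _!; _∸_; NonZero)
open import Data.Nat.Properties as ℕ using (<⇒≤; <⇒≱)
open import Data.Nat.Divisibility using (_∣_; divides; ∣1⇒≡1; ∣⇒≤; m∣m*n; ∣m∣n⇒∣m+n; ∣-refl)
open import Data.Nat.DivMod using (m/n*n≡m)
open import Data.Nat.Primality
  using (euclidsLemma; ¬prime[0]; ¬prime[1]; composite; composite⇒¬prime; prime⇒nonZero; prime⇒nonTrivial)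
open import Data.Nat.Combinatorics using (_C_; nCn≡1; nCk≡n!/k![n-k]!; k![n∸k]!∣n!)
import Data.Fin as Fin
open import Data.Fin.Properties using (inject≤-injective; toℕ-injective; toℕ-inject≤; toℕ<n)
open import Data.Sum using (_⊎_; inj₁; inj₂; [_,_]′)
open import Data.Empty using (⊥; ⊥-elim)
open import Relation.Nullary using (contradiction)
open import Relation.Binary.PropositionalEquality using (refl; sym; trans; cong; subst)

n∣n! : ∀ n → .{{NonZero n}} → n ∣ n !
n∣n! (suc n) = m∣m*n (n !)

prime∣n!⇒p≤n : ∀ {p} → Prime p → ∀ n → p ∣ n ! → p ≤ n
prime∣n!⇒p≤n pp zero p∣1 = ⊥-elim (¬prime[1] (subst Prime (∣1⇒≡1 p∣1) pp))
prime∣n!⇒p≤n pp (suc n) p∣[1+n]! with euclidsLemma (suc n) (n !) pp p∣[1+n]!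
... | inj₁ p∣1+n = ∣⇒≤ p∣1+n
... | inj₂ p∣n!  = ℕ.m≤n⇒m≤1+n (prime∣n!⇒p≤n pp n p∣n!)

nCk*k![n∸k]!≡n! : ∀ {n k} → k ≤ n → (n C k) ℕ.* (k ! ℕ.* (n ∸ k) !) ≡ n !
nCk*k![n∸k]!≡n! {n} {k} k≤n = trans
  (cong (ℕ._* (k ! ℕ.* (n ∸ k) !)) (nCk≡n!/k![n-k]! k≤n))
  (m/n*n≡m (k![n∸k]!∣n! k≤n))
  where instance _ = k ℕ.!* (n ∸ k) !≢0

prime∣pCk*k![p∸k]! : ∀ {p k} → Prime p → k ≤ p → p ∣ (p C k) ℕ.* (k ! ℕ.* (p ∸ k) !)
prime∣pCk*k![p∸k]! {p} pp k≤p = subst (p ∣_) (sym (nCk*k![n∸k]!≡n! k≤p)) (n∣n! p)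
  where instance _ = prime⇒nonZero pp

-- p divides p!, but neither k! nor (p ∸ k)!, both factorials of numbers below p.
prime∣pCk : ∀ {p k} → Prime p → 0 < k → k < p → p ∣ (p C k)
prime∣pCk {p} {k} pp 0<k k<p
  with euclidsLemma (p C k) (k ! ℕ.* (p ∸ k) !) pp (prime∣pCk*k![p∸k]! pp (<⇒≤ k<p))
... | inj₁ p∣pCk = p∣pCk
... | inj₂ p∣k![p∸k]! with euclidsLemma (k !) ((p ∸ k) !) pp p∣k![p∸k]!
...   | inj₁ p∣k!     = contradiction (prime∣n!⇒p≤n pp k p∣k!) (<⇒≱ k<p)
...   | inj₂ p∣[p∸k]! =
  contradiction (prime∣n!⇒p≤n pp (p ∸ k) p∣[p∸k]!) (<⇒≱ (ℕ.∸-monoʳ-< 0<k (<⇒≤ k<p)))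

prime≢2⇒2∤p : ∀ {p} → Prime p → p ≢ 2 → ¬ 2 ∣ p
prime≢2⇒2∤p {p} pp p≢2 2∣p = composite⇒¬prime (composite 2<p 2∣p) pp
  where
  instance _ = prime⇒nonZero pp
  2<p : 2 < p
  2<p = ℕ.≤∧≢⇒< (∣⇒≤ 2∣p) (λ 2≡p → p≢2 (sym 2≡p))

1<p^s : ∀ {p s} → Prime p → 1 ≤ s → 1 < p ^ s
1<p^s {p} {s} pp 1≤s = ℕ.^-monoʳ-< p (ℕ.nonTrivial⇒n>1 p {{prime⇒nonTrivial pp}}) 1≤s

inject≤-≢ : ∀ {l n} (l≤n : l ≤ n) {i j : Fin l} → i ≢ j → inject≤ i l≤n ≢ inject≤ j l≤n
inject≤-≢ l≤n {i} {j} i≢j ιi≡ιj = i≢j (inject≤-injective l≤n l≤n i j ιi≡ιj)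

≢inject≤-zero⇒1≤toℕ : ∀ {n} (1≤n : 1 ≤ n) {j : Fin n} → j ≢ inject≤ Fin.zero 1≤n → 1 ≤ toℕ j
≢inject≤-zero⇒1≤toℕ 1≤n {j} j≢ι₀ =
  ℕ.n≢0⇒n>0 (λ toℕj≡0 → j≢ι₀ (toℕ-injective (trans toℕj≡0 (sym (toℕ-inject≤ Fin.zero 1≤n)))))

module FiniteField {N : ℕ} (F : FieldOfOrder N) where

  open FieldOfOrder F
  open import Algebra.Bundles using (CommutativeRing)
  open import Data.List using (List; []; _∷_; length; _++_; replicate)
  open import Data.List.Properties using (length-replicate; length-++)
  open import Data.Fin using (inject₁; fromℕ; punchIn)
  open import Data.Fin.Properties using (suc-injective; toℕ-fromℕ; toℕ-inject₁; punchInᵢ≢i)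
  open import Data.Fin.Permutation using (Permutation)
  open import Data.Product using (Σ; _,_)
  open import Function.Bundles using (_↔_; Inverse; mk↔ₛ′)
  open import Function.Construct.Composition using (_↔-∘_)
  open import Function.Construct.Symmetry using (↔-sym)
  open import Relation.Nullary using (Dec; yes; no)
  open import Relation.Binary.PropositionalEquality
    using (cong₂; subst₂; module ≡-Reasoning)
  open ≡-Reasoning

  commutativeRing : CommutativeRing _ _
  commutativeRing = record { isCommutativeRing = isCommutativeRing }

  open CommutativeRing commutativeRing public
    using ( +-assoc; +-comm; *-assoc; *-comm; distribˡ; distribʳ; zeroˡ; zeroʳ
          ; +-identityˡ; +-identityʳ; *-identityˡ; *-identityʳ; -‿inverseˡ; -‿inverseʳ
          ; semiring; commutativeSemiring; +-commutativeMonoid; *-commutativeMonoid )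
  open import Algebra.Properties.Ring (CommutativeRing.ring commutativeRing) public
    using ( -‿involutive; -‿distribˡ-*; -‿distribʳ-*; +-cancelˡ; +-inverseˡ-unique; x∙y⁻¹≈ε⇒x≈y
          ; x+x≈x⇒x≈0; -0#≈0#; \\-leftDividesˡ; \\-leftDividesʳ; -1*x≈-x )
  open import Algebra.Properties.Semiring.Mult semiring public
    using (×-assoc-*; ×1-homo-*)
    renaming (_×_ to _×ₙ_)
  import Algebra.Properties.Semiring.Exp semiring as Exp
  import Algebra.Properties.CommutativeSemiring.Exp commutativeSemiring as CExp
  import Algebra.Properties.CommutativeSemiring.Binomial commutativeSemiring as Binomial
  import Algebra.Properties.CommutativeMonoid.Sum +-commutativeMonoid as Sum
  import Algebra.Properties.CommutativeMonoid.Sum *-commutativeMonoid as Product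
  open import Algebra.Solver.Ring.NaturalCoefficients.Default commutativeSemiring public

  1≢0 : 1# ≢ 0#
  1≢0 1≡0 = 0≢1 (sym 1≡0)

  inverseˡ : ∀ x → x ≢ 0# → x ⁻¹ * x ≡ 1#
  inverseˡ x x≢0 = trans (*-comm _ _) (inverseʳ x x≢0)

  x⁻¹*[x*y]≡y : ∀ {x} → x ≢ 0# → ∀ y → x ⁻¹ * (x * y) ≡ y
  x⁻¹*[x*y]≡y {x} x≢0 y = begin
    x ⁻¹ * (x * y)   ≡⟨ sym (*-assoc _ _ _) ⟩
    x ⁻¹ * x * y     ≡⟨ cong (_* y) (inverseˡ x x≢0) ⟩
    1# * y           ≡⟨ *-identityˡ y ⟩
    y                ∎

  x≢0∧x*y≡0⇒y≡0 : ∀ {x y} → x ≢ 0# → x * y ≡ 0# → y ≡ 0#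
  x≢0∧x*y≡0⇒y≡0 {x} {y} x≢0 xy≡0 = begin
    y                ≡⟨ sym (x⁻¹*[x*y]≡y x≢0 y) ⟩
    x ⁻¹ * (x * y)   ≡⟨ cong (x ⁻¹ *_) xy≡0 ⟩
    x ⁻¹ * 0#        ≡⟨ zeroʳ _ ⟩
    0#               ∎

  *-nonzero : ∀ {x y} → x ≢ 0# → y ≢ 0# → x * y ≢ 0#
  *-nonzero x≢0 y≢0 xy≡0 = y≢0 (x≢0∧x*y≡0⇒y≡0 x≢0 xy≡0)

  x*x≡0⇒x≡0 : ∀ {x} → x * x ≡ 0# → x ≡ 0#
  x*x≡0⇒x≡0 {x} xx≡0 with x ≟ 0#
  ... | yes x≡0 = x≡0
  ... | no x≢0 = x≢0∧x*y≡0⇒y≡0 x≢0 xx≡0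

  ⁻¹-nonzero : ∀ {x} → x ≢ 0# → x ⁻¹ ≢ 0#
  ⁻¹-nonzero {x} x≢0 x⁻¹≡0 = 0≢1 (begin
    0#           ≡⟨ sym (zeroʳ x) ⟩
    x * 0#       ≡⟨ cong (x *_) (sym x⁻¹≡0) ⟩
    x * x ⁻¹     ≡⟨ inverseʳ x x≢0 ⟩
    1#           ∎)

  x*y≡y⇒x≡1 : ∀ {x y} → y ≢ 0# → x * y ≡ y → x ≡ 1#
  x*y≡y⇒x≡1 {x} {y} y≢0 xy≡y = begin
    x                ≡⟨ sym (*-identityʳ x) ⟩
    x * 1#           ≡⟨ cong (x *_) (sym (inverseʳ y y≢0)) ⟩
    x * (y * y ⁻¹)   ≡⟨ sym (*-assoc _ _ _) ⟩
    x * y * y ⁻¹     ≡⟨ cong (_* y ⁻¹) xy≡y ⟩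
    y * y ⁻¹         ≡⟨ inverseʳ y y≢0 ⟩
    1#               ∎

  pow≡^ : ∀ x k → pow x k ≡ x Exp.^ k
  pow≡^ x zero    = refl
  pow≡^ x (suc k) = cong (x *_) (pow≡^ x k)

  pow-assocʳ : ∀ x m k → pow (pow x m) k ≡ pow x (m ℕ.* k)
  pow-assocʳ x m k = begin
    pow (pow x m) k         ≡⟨ pow≡^ _ k ⟩
    pow x m Exp.^ k         ≡⟨ cong (Exp._^ k) (pow≡^ x m) ⟩
    (x Exp.^ m) Exp.^ k     ≡⟨ Exp.^-assocʳ x m k ⟩
    x Exp.^ (m ℕ.* k)       ≡⟨ sym (pow≡^ x (m ℕ.* k)) ⟩
    pow x (m ℕ.* k)         ∎

  pow-distrib-* : ∀ x y k → pow (x * y) k ≡ pow x k * pow y k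
  pow-distrib-* x y k = begin
    pow (x * y) k           ≡⟨ pow≡^ _ k ⟩
    (x * y) Exp.^ k         ≡⟨ CExp.^-distrib-* x y k ⟩
    x Exp.^ k * y Exp.^ k   ≡⟨ sym (cong₂ _*_ (pow≡^ x k) (pow≡^ y k)) ⟩
    pow x k * pow y k       ∎

  pow-1# : ∀ k → pow 1# k ≡ 1#
  pow-1# zero    = refl
  pow-1# (suc k) = trans (*-identityˡ _) (pow-1# k)

  pow-nonzero : ∀ {x} k → x ≢ 0# → pow x k ≢ 0#
  pow-nonzero zero    x≢0 = 1≢0
  pow-nonzero (suc k) x≢0 = *-nonzero x≢0 (pow-nonzero k x≢0)

  pow≡0⇒x≡0 : ∀ x k → pow x k ≡ 0# → x ≡ 0#
  pow≡0⇒x≡0 x k xᵏ≡0 with x ≟ 0#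
  ... | yes x≡0 = x≡0
  ... | no x≢0  = ⊥-elim (pow-nonzero k x≢0 xᵏ≡0)

  -x*-y*-z≡-[x*y*z] : ∀ x y z → - x * - y * - z ≡ - (x * y * z)
  -x*-y*-z≡-[x*y*z] x y z = begin
    - x * - y * - z      ≡⟨ cong (_* - z) (sym (-‿distribˡ-* x (- y))) ⟩
    - (x * - y) * - z    ≡⟨ cong (λ w → - w * - z) (sym (-‿distribʳ-* x y)) ⟩
    - - (x * y) * - z    ≡⟨ cong (_* - z) (-‿involutive _) ⟩
    x * y * - z          ≡⟨ sym (-‿distribʳ-* _ z) ⟩
    - (x * y * z)        ∎

  x≡-x⇒x≡0 : 1# + 1# ≢ 0# → ∀ {x} → x ≡ - x → x ≡ 0#
  x≡-x⇒x≡0 2≢0 {x} x≡-x = x≢0∧x*y≡0⇒y≡0 2≢0 (begin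
    (1# + 1#) * x   ≡⟨ solve 1 (λ x → (con 1 :+ con 1) :* x := x :+ x) refl x ⟩
    x + x           ≡⟨ cong (x +_) x≡-x ⟩
    x + - x         ≡⟨ -‿inverseʳ x ⟩
    0#              ∎)

  Σᶠ-cong : ∀ n {f g : Fin n → Carrier} → (∀ i → f i ≡ g i) → Σᶠ n f ≡ Σᶠ n g
  Σᶠ-cong zero    f≗g = refl
  Σᶠ-cong (suc n) f≗g = cong₂ _+_ (f≗g Fin.zero) (Σᶠ-cong n (λ i → f≗g (Fin.suc i)))

  Πᶠ-cong : ∀ n {f g : Fin n → Carrier} → (∀ i → f i ≡ g i) → Πᶠ n f ≡ Πᶠ n g
  Πᶠ-cong zero    f≗g = refl
  Πᶠ-cong (suc n) f≗g = cong₂ _*_ (f≗g Fin.zero) (Πᶠ-cong n (λ i → f≗g (Fin.suc i)))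

  Σᶠ≡sum : ∀ n f → Σᶠ n f ≡ Sum.sum f
  Σᶠ≡sum zero    f = refl
  Σᶠ≡sum (suc n) f = cong (f Fin.zero +_) (Σᶠ≡sum n (λ i → f (Fin.suc i)))

  Πᶠ≡product : ∀ n f → Πᶠ n f ≡ Product.sum f
  Πᶠ≡product zero    f = refl
  Πᶠ≡product (suc n) f = cong (f Fin.zero *_) (Πᶠ≡product n (λ i → f (Fin.suc i)))

  Σᶠ-distrib-+ : ∀ n (f g : Fin n → Carrier) → Σᶠ n (λ i → f i + g i) ≡ Σᶠ n f + Σᶠ n g
  Σᶠ-distrib-+ zero    f g = sym (+-identityˡ 0#)
  Σᶠ-distrib-+ (suc n) f g = trans
    (cong (f Fin.zero + g Fin.zero +_) (Σᶠ-distrib-+ n _ _))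
    (solve 4 (λ a b c d → (a :+ b) :+ (c :+ d) := (a :+ c) :+ (b :+ d)) refl
      (f Fin.zero) (g Fin.zero) (Σᶠ n (λ i → f (Fin.suc i))) (Σᶠ n (λ i → g (Fin.suc i))))

  Πᶠ-distrib-* : ∀ n (f g : Fin n → Carrier) → Πᶠ n (λ i → f i * g i) ≡ Πᶠ n f * Πᶠ n g
  Πᶠ-distrib-* zero    f g = sym (*-identityˡ 1#)
  Πᶠ-distrib-* (suc n) f g = trans
    (cong (f Fin.zero * g Fin.zero *_) (Πᶠ-distrib-* n _ _))
    (solve 4 (λ a b c d → (a :* b) :* (c :* d) := (a :* c) :* (b :* d)) refl
      (f Fin.zero) (g Fin.zero) (Πᶠ n (λ i → f (Fin.suc i))) (Πᶠ n (λ i → g (Fin.suc i))))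

  *-distribˡ-Σᶠ : ∀ n x (f : Fin n → Carrier) → x * Σᶠ n f ≡ Σᶠ n (λ i → x * f i)
  *-distribˡ-Σᶠ zero    x f = zeroʳ x
  *-distribˡ-Σᶠ (suc n) x f = trans (distribˡ _ _ _) (cong (x * f Fin.zero +_) (*-distribˡ-Σᶠ n x _))

  *-distribʳ-Σᶠ : ∀ n x (f : Fin n → Carrier) → Σᶠ n f * x ≡ Σᶠ n (λ i → f i * x)
  *-distribʳ-Σᶠ n x f = trans (*-comm _ x) (trans (*-distribˡ-Σᶠ n x f) (Σᶠ-cong n (λ i → *-comm x (f i))))

  Σᶠ-const : ∀ n x → Σᶠ n (λ _ → x) ≡ n ×ₙ x
  Σᶠ-const zero    x = refl
  Σᶠ-const (suc n) x = cong (x +_) (Σᶠ-const n x)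

  Σᶠ-zero : ∀ n → Σᶠ n (λ _ → 0#) ≡ 0#
  Σᶠ-zero zero    = refl
  Σᶠ-zero (suc n) = trans (+-identityˡ _) (Σᶠ-zero n)

  Πᶠ-const : ∀ n x → Πᶠ n (λ _ → x) ≡ pow x n
  Πᶠ-const zero    x = refl
  Πᶠ-const (suc n) x = cong (x *_) (Πᶠ-const n x)

  Πᶠ-nonzero : ∀ n (f : Fin n → Carrier) → (∀ i → f i ≢ 0#) → Πᶠ n f ≢ 0#
  Πᶠ-nonzero zero    f f≢0 = 1≢0
  Πᶠ-nonzero (suc n) f f≢0 = *-nonzero (f≢0 Fin.zero) (Πᶠ-nonzero n _ (λ i → f≢0 (Fin.suc i)))

  Σᶠ-swap : ∀ m n (f : Fin m → Fin n → Carrier) →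
            Σᶠ m (λ i → Σᶠ n (f i)) ≡ Σᶠ n (λ j → Σᶠ m (λ i → f i j))
  Σᶠ-swap zero    n f = sym (Σᶠ-zero n)
  Σᶠ-swap (suc m) n f = begin
    Σᶠ n (f Fin.zero) + Σᶠ m (λ i → Σᶠ n (f (Fin.suc i)))
      ≡⟨ cong (Σᶠ n (f Fin.zero) +_) (Σᶠ-swap m n (λ i → f (Fin.suc i))) ⟩
    Σᶠ n (f Fin.zero) + Σᶠ n (λ j → Σᶠ m (λ i → f (Fin.suc i) j))
      ≡⟨ sym (Σᶠ-distrib-+ n _ _) ⟩
    Σᶠ n (λ j → f Fin.zero j + Σᶠ m (λ i → f (Fin.suc i) j)) ∎

  Σᶠ-single : ∀ m (f : Fin m → Carrier) j → (∀ i → i ≢ j → f i ≡ 0#) → Σᶠ m f ≡ f j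
  Σᶠ-single (suc m) f j f-elsewhere = begin
    Σᶠ (suc m) f                              ≡⟨ Σᶠ≡sum (suc m) f ⟩
    Sum.sum f                                 ≡⟨ Sum.sum-remove {i = j} f ⟩
    f j + Sum.sum (λ i → f (punchIn j i))     ≡⟨ cong (f j +_) (sym (Σᶠ≡sum m _)) ⟩
    f j + Σᶠ m (λ i → f (punchIn j i))        ≡⟨ cong (f j +_) (trans (Σᶠ-cong m others) (Σᶠ-zero m)) ⟩
    f j + 0#                                  ≡⟨ +-identityʳ _ ⟩
    f j                                       ∎
    where
    others : ∀ i → f (punchIn j i) ≡ 0#
    others i = f-elsewhere (punchIn j i) (punchInᵢ≢i j i)

  Σᶠ-product : ∀ m (f g : Fin m → Carrier) → Σᶠ m (λ j → Σᶠ m (λ k → f k * g j)) ≡ Σᶠ m f * Σᶠ m g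
  Σᶠ-product m f g = begin
    Σᶠ m (λ j → Σᶠ m (λ k → f k * g j))   ≡⟨ Σᶠ-cong m (λ j → sym (*-distribʳ-Σᶠ m (g j) f)) ⟩
    Σᶠ m (λ j → Σᶠ m f * g j)             ≡⟨ sym (*-distribˡ-Σᶠ m (Σᶠ m f) g) ⟩
    Σᶠ m f * Σᶠ m g                       ∎

  Σᶠ-init-last : ∀ n (f : Fin (suc n) → Carrier) → Σᶠ (suc n) f ≡ Σᶠ n (λ i → f (inject₁ i)) + f (fromℕ n)
  Σᶠ-init-last n f = begin
    Σᶠ (suc n) f                               ≡⟨ Σᶠ≡sum (suc n) f ⟩
    Sum.sum f                                  ≡⟨ Sum.sum-init-last f ⟩
    Sum.sum (λ i → f (inject₁ i)) + f (fromℕ n) ≡⟨ cong (_+ f (fromℕ n)) (sym (Σᶠ≡sum n _)) ⟩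
    Σᶠ n (λ i → f (inject₁ i)) + f (fromℕ n)   ∎

  Σᶠ-rotate : ∀ n → 1 ≤ n → (g : ℕ → Carrier) → g n ≡ g 0 →
              Σᶠ n (λ i → g (suc (toℕ i))) ≡ Σᶠ n (λ i → g (toℕ i))
  Σᶠ-rotate (suc m) _ g gₙ≡g₀ = +-cancelˡ (g 0) _ _ (begin
    Σᶠ (suc (suc m)) (λ i → g (toℕ i))
      ≡⟨ Σᶠ-init-last (suc m) (λ i → g (toℕ i)) ⟩
    Σᶠ (suc m) (λ i → g (toℕ (inject₁ i))) + g (toℕ (fromℕ (suc m)))
      ≡⟨ cong₂ _+_ (Σᶠ-cong (suc m) (λ i → cong g (toℕ-inject₁ i))) (trans (cong g (toℕ-fromℕ (suc m))) gₙ≡g₀) ⟩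
    Σᶠ (suc m) (λ i → g (toℕ i)) + g 0
      ≡⟨ +-comm _ _ ⟩
    g 0 + Σᶠ (suc m) (λ i → g (toℕ i)) ∎)

  index : Carrier → Fin N
  index = Inverse.to enum

  elem-index : ∀ x → elem (index x) ≡ x
  elem-index = Inverse.strictlyInverseʳ enum

  elem-injective : ∀ {i j} → elem i ≡ elem j → i ≡ j
  elem-injective {i} {j} eᵢ≡eⱼ = begin
    i                ≡⟨ sym (Inverse.strictlyInverseˡ enum i) ⟩
    index (elem i)   ≡⟨ cong index eᵢ≡eⱼ ⟩
    index (elem j)   ≡⟨ Inverse.strictlyInverseˡ enum j ⟩
    j                ∎

  elemPermutation : Carrier ↔ Carrier → Permutation N N
  elemPermutation π = enum ↔-∘ (π ↔-∘ ↔-sym enum)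

  Σᶠ-reindex : (π : Carrier ↔ Carrier) (h : Carrier → Carrier) →
               Σᶠ N (λ k → h (elem k)) ≡ Σᶠ N (λ k → h (Inverse.to π (elem k)))
  Σᶠ-reindex π h = begin
    Σᶠ N (λ k → h (elem k))
      ≡⟨ Σᶠ≡sum N _ ⟩
    Sum.sum (λ k → h (elem k))
      ≡⟨ Sum.sum-permute _ (elemPermutation π) ⟩
    Sum.sum (λ k → h (elem (index (Inverse.to π (elem k)))))
      ≡⟨ sym (Σᶠ≡sum N _) ⟩
    Σᶠ N (λ k → h (elem (index (Inverse.to π (elem k)))))
      ≡⟨ Σᶠ-cong N (λ k → cong h (elem-index _)) ⟩
    Σᶠ N (λ k → h (Inverse.to π (elem k))) ∎

  Πᶠ-reindex : (π : Carrier ↔ Carrier) (h : Carrier → Carrier) →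
               Πᶠ N (λ k → h (elem k)) ≡ Πᶠ N (λ k → h (Inverse.to π (elem k)))
  Πᶠ-reindex π h = begin
    Πᶠ N (λ k → h (elem k))
      ≡⟨ Πᶠ≡product N _ ⟩
    Product.sum (λ k → h (elem k))
      ≡⟨ Product.sum-permute _ (elemPermutation π) ⟩
    Product.sum (λ k → h (elem (index (Inverse.to π (elem k)))))
      ≡⟨ sym (Πᶠ≡product N _) ⟩
    Πᶠ N (λ k → h (elem (index (Inverse.to π (elem k)))))
      ≡⟨ Πᶠ-cong N (λ k → cong h (elem-index _)) ⟩
    Πᶠ N (λ k → h (Inverse.to π (elem k))) ∎

  translation : Carrier → Carrier ↔ Carrier
  translation x = mk↔ₛ′ (x +_) (- x +_) (\\-leftDividesˡ x) (\\-leftDividesʳ x)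

  x*[x⁻¹*y]≡y : ∀ {x} → x ≢ 0# → ∀ y → x * (x ⁻¹ * y) ≡ y
  x*[x⁻¹*y]≡y {x} x≢0 y = begin
    x * (x ⁻¹ * y)   ≡⟨ sym (*-assoc _ _ _) ⟩
    x * x ⁻¹ * y     ≡⟨ cong (_* y) (inverseʳ x x≢0) ⟩
    1# * y           ≡⟨ *-identityˡ y ⟩
    y                ∎

  scaling : ∀ {x} → x ≢ 0# → Carrier ↔ Carrier
  scaling {x} x≢0 = mk↔ₛ′ (x *_) (x ⁻¹ *_) (x*[x⁻¹*y]≡y x≢0) (x⁻¹*[x*y]≡y x≢0)

  -- Translating by x permutes the elements, so Σ (x + y) = Σ y over the whole field.
  N×x≡0 : ∀ x → N ×ₙ x ≡ 0#
  N×x≡0 x = +-cancelˡ S (N ×ₙ x) 0# (begin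
    S + N ×ₙ x                 ≡⟨ +-comm S _ ⟩
    N ×ₙ x + S                 ≡⟨ cong (_+ S) (sym (Σᶠ-const N x)) ⟩
    Σᶠ N (λ _ → x) + S         ≡⟨ sym (Σᶠ-distrib-+ N _ _) ⟩
    Σᶠ N (λ k → x + elem k)    ≡⟨ sym (Σᶠ-reindex (translation x) (λ y → y)) ⟩
    S                          ≡⟨ sym (+-identityʳ S) ⟩
    S + 0#                     ∎)
    where
    S : Carrier
    S = Σᶠ N elem

  ^×1#≡pow : ∀ p m → (p ^ m) ×ₙ 1# ≡ pow (p ×ₙ 1#) m
  ^×1#≡pow p zero    = +-identityʳ 1#
  ^×1#≡pow p (suc m) = trans (×1-homo-* p (p ^ m)) (cong (p ×ₙ 1# *_) (^×1#≡pow p m))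

  characteristic : ∀ {p m} → N ≡ p ^ m → p ×ₙ 1# ≡ 0#
  characteristic {p} {m} N≡pᵐ = pow≡0⇒x≡0 (p ×ₙ 1#) m (begin
    pow (p ×ₙ 1#) m       ≡⟨ sym (^×1#≡pow p m) ⟩
    (p ^ m) ×ₙ 1#       ≡⟨ cong (_×ₙ 1#) (sym N≡pᵐ) ⟩
    N ×ₙ 1#               ≡⟨ N×x≡0 1# ⟩
    0#                    ∎)

  p×1#≡0∧p∣m⇒m×x≡0 : ∀ {p m} → p ×ₙ 1# ≡ 0# → p ∣ m → ∀ x → m ×ₙ x ≡ 0#
  p×1#≡0∧p∣m⇒m×x≡0 {p} p×1#≡0 (divides d refl) x = begin
    (d ℕ.* p) ×ₙ x                ≡⟨ cong ((d ℕ.* p) ×ₙ_) (sym (*-identityˡ x)) ⟩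
    (d ℕ.* p) ×ₙ (1# * x)         ≡⟨ sym (×-assoc-* (d ℕ.* p) 1# x) ⟩
    (d ℕ.* p) ×ₙ 1# * x           ≡⟨ cong (_* x) (×1-homo-* d p) ⟩
    d ×ₙ 1# * (p ×ₙ 1#) * x       ≡⟨ cong (λ z → d ×ₙ 1# * z * x) p×1#≡0 ⟩
    d ×ₙ 1# * 0# * x              ≡⟨ cong (_* x) (zeroʳ _) ⟩
    0# * x                        ≡⟨ zeroˡ x ⟩
    0#                            ∎

  unit : Carrier → Carrier
  unit y with y ≟ 0#
  ... | yes _ = 1#
  ... | no  _ = y

  unit-nonzero : ∀ y → unit y ≢ 0#
  unit-nonzero y with y ≟ 0#
  ... | yes _   = 1≢0
  ... | no  y≢0 = y≢0

  scaleFactor : Carrier → Carrier → Carrier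
  scaleFactor x y with y ≟ 0#
  ... | yes _ = 1#
  ... | no  _ = x

  unit-* : ∀ {x} → x ≢ 0# → ∀ y → unit (x * y) ≡ scaleFactor x y * unit y
  unit-* {x} x≢0 y with y ≟ 0# | (x * y) ≟ 0#
  ... | yes _    | yes _     = sym (*-identityˡ 1#)
  ... | yes y≡0  | no xy≢0   = ⊥-elim (xy≢0 (trans (cong (x *_) y≡0) (zeroʳ x)))
  ... | no  y≢0  | yes xy≡0  = ⊥-elim (*-nonzero x≢0 y≢0 xy≡0)
  ... | no  _    | no  _     = refl

  Πᶠ-scaleFactor : ∀ x m (e : Fin m → Carrier) → (∀ {i j} → e i ≡ e j → i ≡ j) →
                   ∀ i₀ → e i₀ ≡ 0# → Πᶠ m (λ k → scaleFactor x (e k)) * x ≡ pow x m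
  Πᶠ-scaleFactor x (suc m) e e-injective i₀ eᵢ₀≡0 = begin
    Πᶠ (suc m) (λ k → scaleFactor x (e k)) * x
      ≡⟨ cong (_* x) (Πᶠ≡product (suc m) (λ k → scaleFactor x (e k))) ⟩
    Product.sum (λ k → scaleFactor x (e k)) * x
      ≡⟨ cong (_* x) (Product.sum-remove {i = i₀} (λ k → scaleFactor x (e k))) ⟩
    scaleFactor x (e i₀) * Product.sum (λ j → scaleFactor x (e (punchIn i₀ j))) * x
      ≡⟨ cong₂ (λ a b → a * b * x) at-i₀ (sym (Πᶠ≡product m _)) ⟩
    1# * Πᶠ m (λ j → scaleFactor x (e (punchIn i₀ j))) * x
      ≡⟨ cong (λ a → 1# * a * x) (trans (Πᶠ-cong m away-from-i₀) (Πᶠ-const m x)) ⟩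
    1# * pow x m * x
      ≡⟨ solve 2 (λ a x → con 1 :* a :* x := x :* a) refl (pow x m) x ⟩
    pow x (suc m) ∎
    where
    at-i₀ : scaleFactor x (e i₀) ≡ 1#
    at-i₀ with e i₀ ≟ 0#
    ... | yes _    = refl
    ... | no eᵢ₀≢0 = ⊥-elim (eᵢ₀≢0 eᵢ₀≡0)
    away-from-i₀ : ∀ j → scaleFactor x (e (punchIn i₀ j)) ≡ x
    away-from-i₀ j with e (punchIn i₀ j) ≟ 0#
    ... | yes eⱼ≡0 = ⊥-elim (punchInᵢ≢i i₀ j (e-injective (trans eⱼ≡0 (sym eᵢ₀≡0))))
    ... | no _     = refl

  -- Multiplying by x ≢ 0 permutes the elements; comparing the products of their units
  -- shows that x contributes the factor 1 on the nonzero elements.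
  Πᶠ-scaleFactor≡1 : ∀ {x} → x ≢ 0# → Πᶠ N (λ k → scaleFactor x (elem k)) ≡ 1#
  Πᶠ-scaleFactor≡1 {x} x≢0 = x*y≡y⇒x≡1 (Πᶠ-nonzero N _ (λ k → unit-nonzero _)) (begin
    Πᶠ N (λ k → scaleFactor x (elem k)) * Πᶠ N (λ k → unit (elem k))
      ≡⟨ sym (Πᶠ-distrib-* N _ _) ⟩
    Πᶠ N (λ k → scaleFactor x (elem k) * unit (elem k))
      ≡⟨ Πᶠ-cong N (λ k → sym (unit-* x≢0 (elem k))) ⟩
    Πᶠ N (λ k → unit (x * elem k))
      ≡⟨ sym (Πᶠ-reindex (scaling x≢0) unit) ⟩
    Πᶠ N (λ k → unit (elem k)) ∎)

  pow-N : ∀ x → pow x N ≡ x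
  pow-N x = trans (sym (Πᶠ-scaleFactor x N elem elem-injective (index 0#) (elem-index 0#))) (by-cases (x ≟ 0#))
    where
    by-cases : Dec (x ≡ 0#) → Πᶠ N (λ k → scaleFactor x (elem k)) * x ≡ x
    by-cases (yes x≡0) = trans (cong (Πᶠ N (λ k → scaleFactor x (elem k)) *_) x≡0) (trans (zeroʳ _) (sym x≡0))
    by-cases (no x≢0)  = trans (cong (_* x) (Πᶠ-scaleFactor≡1 x≢0)) (*-identityˡ x)

  binomialTerm-first : ∀ x y n → Binomial.binomialTerm x y n Fin.zero ≡ pow y n
  binomialTerm-first x y n = trans (+-identityʳ _) (trans (*-identityˡ _) (sym (pow≡^ y n)))

  binomialTerm-last : ∀ x y n → Binomial.binomialTerm x y n (fromℕ n) ≡ pow x n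
  binomialTerm-last x y n rewrite toℕ-fromℕ n | nCn≡1 n | ℕ.n∸n≡0 n =
    trans (+-identityʳ _) (trans (*-identityʳ _) (sym (pow≡^ x n)))

  pow-+-prime : ∀ {p} → Prime p → p ×ₙ 1# ≡ 0# → ∀ x y → pow (x + y) p ≡ pow x p + pow y p
  pow-+-prime {zero}        pp = ⊥-elim (¬prime[0] pp)
  pow-+-prime {suc zero}    pp = ⊥-elim (¬prime[1] pp)
  pow-+-prime {suc (suc r)} pp p×1#≡0 x y = begin
    pow (x + y) p
      ≡⟨ pow≡^ (x + y) p ⟩
    (x + y) Exp.^ p
      ≡⟨ Binomial.theorem p x y ⟩
    Binomial.binomialExpansion x y p
      ≡⟨ sym (Σᶠ≡sum (suc p) t) ⟩
    t Fin.zero + Σᶠ p (λ i → t (Fin.suc i))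
      ≡⟨ cong (t Fin.zero +_) (Σᶠ-init-last (suc r) (λ i → t (Fin.suc i))) ⟩
    t Fin.zero + (Σᶠ (suc r) inner + t (fromℕ p))
      ≡⟨ cong (λ z → t Fin.zero + (z + t (fromℕ p))) inner-vanishes ⟩
    t Fin.zero + (0# + t (fromℕ p))
      ≡⟨ cong₂ (λ a b → a + (0# + b)) (binomialTerm-first x y p) (binomialTerm-last x y p) ⟩
    pow y p + (0# + pow x p)
      ≡⟨ solve 2 (λ a b → a :+ (con 0 :+ b) := b :+ a) refl (pow y p) (pow x p) ⟩
    pow x p + pow y p ∎
    where
    p : ℕ
    p = suc (suc r)
    t : Fin (suc p) → Carrier
    t = Binomial.binomialTerm x y p
    inner : Fin (suc r) → Carrier
    inner i = t (Fin.suc (inject₁ i))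
    inner-vanishes : Σᶠ (suc r) inner ≡ 0#
    inner-vanishes = trans (Σᶠ-cong (suc r) inner≡0) (Σᶠ-zero (suc r))
      where
      k<p : ∀ i → toℕ (Fin.suc (inject₁ i)) < p
      k<p i = ℕ.s≤s (subst (_< suc r) (sym (toℕ-inject₁ i)) (toℕ<n i))
      inner≡0 : ∀ i → inner i ≡ 0#
      inner≡0 i = p×1#≡0∧p∣m⇒m×x≡0 p×1#≡0 (prime∣pCk pp (ℕ.s≤s ℕ.z≤n) (k<p i))
                    (Binomial.binomial x y p (Fin.suc (inject₁ i)))

  -- c₀ ∷ ⋯ ∷ c_{d-1} stands for the monic polynomial c₀ + c₁X + ⋯ + c_{d-1}X^{d-1} + X^d.
  monicAt : List Carrier → Carrier → Carrier
  monicAt []       x = 1#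
  monicAt (c ∷ cs) x = c + x * monicAt cs x

  polyAt : List Carrier → Carrier → Carrier
  polyAt []       x = 0#
  polyAt (c ∷ cs) x = c + x * polyAt cs x

  -- the quotient of c ∷ cs by X - a, which does not depend on c
  quotientBy : Carrier → List Carrier → List Carrier
  quotientBy a []       = []
  quotientBy a (c ∷ cs) = monicAt (c ∷ cs) a ∷ quotientBy a cs

  length-quotientBy : ∀ a cs → length (quotientBy a cs) ≡ length cs
  length-quotientBy a []       = refl
  length-quotientBy a (c ∷ cs) = cong suc (length-quotientBy a cs)

  -- lets the semiring solver, which treats - a as an atom, cancel a against - a
  z+[-a+a]*w≡z : ∀ a w z → z + (- a + a) * w ≡ z
  z+[-a+a]*w≡z a w z = trans (cong (λ b → z + b * w) (-‿inverseˡ a)) (trans (cong (z +_) (zeroˡ w)) (+-identityʳ z))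

  monicAt-division : ∀ a c cs x →
                     monicAt (c ∷ cs) x ≡ (x - a) * monicAt (quotientBy a cs) x + monicAt (c ∷ cs) a
  monicAt-division a c [] x = sym (trans
    (solve 4 (λ x -a c a → (x :+ -a) :* con 1 :+ (c :+ a :* con 1) := (c :+ x :* con 1) :+ (-a :+ a) :* con 1)
             refl x (- a) c a)
    (z+[-a+a]*w≡z a 1# _))
  monicAt-division a c (c′ ∷ cs) x = begin
    c + x * monicAt (c′ ∷ cs) x
      ≡⟨ cong (λ z → c + x * z) (monicAt-division a c′ cs x) ⟩
    c + x * ((x - a) * Q + R)
      ≡⟨ sym (z+[-a+a]*w≡z a R _) ⟩
    c + x * ((x - a) * Q + R) + (- a + a) * R
      ≡⟨ solve 6 (λ c x -a a Q R → c :+ x :* ((x :+ -a) :* Q :+ R) :+ (-a :+ a) :* R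
                                 := (x :+ -a) :* (R :+ x :* Q) :+ (c :+ a :* R)) refl c x (- a) a Q R ⟩
    (x - a) * (R + x * Q) + (c + a * R) ∎
    where
    Q R : Carrier
    Q = monicAt (quotientBy a cs) x
    R = monicAt (c′ ∷ cs) a

  roots≤degree : ∀ cs m (r : Fin m → Carrier) → (∀ {i j} → r i ≡ r j → i ≡ j) →
                 (∀ i → monicAt cs (r i) ≡ 0#) → m ≤ length cs
  roots≤degree cs       zero    r r-injective r-roots = ℕ.z≤n
  roots≤degree []       (suc m) r r-injective r-roots = ⊥-elim (1≢0 (r-roots Fin.zero))
  roots≤degree (c ∷ cs) (suc m) r r-injective r-roots = ℕ.s≤s (subst (m ≤_) (length-quotientBy a cs)
    (roots≤degree (quotientBy a cs) m (λ i → r (Fin.suc i)) (λ rᵢ≡rⱼ → suc-injective (r-injective rᵢ≡rⱼ))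
                  quotient-roots))
    where
    a : Carrier
    a = r Fin.zero
    quotient-roots : ∀ i → monicAt (quotientBy a cs) (r (Fin.suc i)) ≡ 0#
    quotient-roots i = x≢0∧x*y≡0⇒y≡0 r₁₊ᵢ-a≢0 (begin
      P                                   ≡⟨ sym (+-identityʳ P) ⟩
      P + 0#                              ≡⟨ cong (P +_) (sym (r-roots Fin.zero)) ⟩
      P + monicAt (c ∷ cs) a              ≡⟨ sym (monicAt-division a c cs (r (Fin.suc i))) ⟩
      monicAt (c ∷ cs) (r (Fin.suc i))    ≡⟨ r-roots (Fin.suc i) ⟩
      0#                                  ∎)
      where
      P : Carrier
      P = (r (Fin.suc i) - a) * monicAt (quotientBy a cs) (r (Fin.suc i))
      r₁₊ᵢ-a≢0 : r (Fin.suc i) - a ≢ 0#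
      r₁₊ᵢ-a≢0 r₁₊ᵢ-a≡0 with r-injective (x∙y⁻¹≈ε⇒x≈y _ _ r₁₊ᵢ-a≡0)
      ... | ()

  MonicOfDegree : ℕ → (Carrier → Carrier) → Set
  MonicOfDegree d f = Σ (List Carrier) λ cs → length cs ≡ d × (∀ x → monicAt cs x ≡ f x)

  monic-cong : ∀ {d f g} → MonicOfDegree d f → (∀ x → f x ≡ g x) → MonicOfDegree d g
  monic-cong (cs , deg , cs≗f) f≗g = cs , deg , λ x → trans (cs≗f x) (f≗g x)

  monic-pow : ∀ k → MonicOfDegree k (λ x → pow x k)
  monic-pow k = replicate k 0# , length-replicate k , monicAt-replicate k
    where
    monicAt-replicate : ∀ k x → monicAt (replicate k 0#) x ≡ pow x k
    monicAt-replicate zero    x = refl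
    monicAt-replicate (suc k) x = trans (+-identityˡ _) (cong (x *_) (monicAt-replicate k x))

  addCoefficients : List Carrier → List Carrier → List Carrier
  addCoefficients cs       []       = cs
  addCoefficients []       (d ∷ ds) = []
  addCoefficients (c ∷ cs) (d ∷ ds) = c + d ∷ addCoefficients cs ds

  length-addCoefficients : ∀ cs ds → length ds ≤ length cs → length (addCoefficients cs ds) ≡ length cs
  length-addCoefficients cs       []       _            = refl
  length-addCoefficients (c ∷ cs) (d ∷ ds) (ℕ.s≤s ds≤cs) = cong suc (length-addCoefficients cs ds ds≤cs)

  monicAt-addCoefficients : ∀ cs ds → length ds ≤ length cs → ∀ x →
                            monicAt (addCoefficients cs ds) x ≡ monicAt cs x + polyAt ds x
  monicAt-addCoefficients cs       []       _            x = sym (+-identityʳ _)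
  monicAt-addCoefficients (c ∷ cs) (d ∷ ds) (ℕ.s≤s ds≤cs) x = begin
    c + d + x * monicAt (addCoefficients cs ds) x
      ≡⟨ cong (λ z → c + d + x * z) (monicAt-addCoefficients cs ds ds≤cs x) ⟩
    c + d + x * (monicAt cs x + polyAt ds x)
      ≡⟨ solve 5 (λ c d x a b → c :+ d :+ x :* (a :+ b) := (c :+ x :* a) :+ (d :+ x :* b))
                 refl c d x (monicAt cs x) (polyAt ds x) ⟩
    (c + x * monicAt cs x) + (d + x * polyAt ds x) ∎

  polyAt-++-1# : ∀ cs x → polyAt (cs ++ 1# ∷ []) x ≡ monicAt cs x
  polyAt-++-1# []       x = trans (cong (1# +_) (zeroʳ x)) (+-identityʳ 1#)
  polyAt-++-1# (c ∷ cs) x = cong (λ z → c + x * z) (polyAt-++-1# cs x)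

  monic-+ : ∀ {d e f g} → e < d → MonicOfDegree d f → MonicOfDegree e g → MonicOfDegree d (λ x → f x + g x)
  monic-+ {d} {e} {f} {g} e<d (cs , deg-cs , cs≗f) (ds , deg-ds , ds≗g) =
    addCoefficients cs ds′ , trans (length-addCoefficients cs ds′ ds′≤cs) deg-cs ,
    λ x → trans (monicAt-addCoefficients cs ds′ ds′≤cs x) (cong₂ _+_ (cs≗f x) (trans (polyAt-++-1# ds x) (ds≗g x)))
    where
    ds′ : List Carrier
    ds′ = ds ++ 1# ∷ []
    ds′≤cs : length ds′ ≤ length cs
    ds′≤cs = subst₂ _≤_ (sym (trans (length-++ ds) (trans (ℕ.+-comm _ 1) (cong suc deg-ds)))) (sym deg-cs) e<d

  vanishing-monic⇒N≤degree : ∀ {d f} → MonicOfDegree d f → (∀ x → f x ≡ 0#) → N ≤ d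
  vanishing-monic⇒N≤degree (cs , deg , cs≗f) f≗0 =
    subst (N ≤_) deg (roots≤degree cs N elem elem-injective (λ i → trans (cs≗f (elem i)) (f≗0 (elem i))))

  PowAdditive : ℕ → Set
  PowAdditive e = ∀ x y → pow (x + y) e ≡ pow x e + pow y e

  powAdditive-* : ∀ {a b} → PowAdditive a → PowAdditive b → PowAdditive (a ℕ.* b)
  powAdditive-* {a} {b} a-additive b-additive x y = begin
    pow (x + y) (a ℕ.* b)                   ≡⟨ sym (pow-assocʳ (x + y) a b) ⟩
    pow (pow (x + y) a) b                   ≡⟨ cong (λ z → pow z b) (a-additive x y) ⟩
    pow (pow x a + pow y a) b               ≡⟨ b-additive _ _ ⟩
    pow (pow x a) b + pow (pow y a) b       ≡⟨ cong₂ _+_ (pow-assocʳ x a b) (pow-assocʳ y a b) ⟩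
    pow x (a ℕ.* b) + pow y (a ℕ.* b)       ∎

  powAdditive-^ : ∀ a → PowAdditive a → ∀ k → PowAdditive (a ^ k)
  powAdditive-^ a a-additive zero    x y = trans (*-identityʳ _) (sym (cong₂ _+_ (*-identityʳ x) (*-identityʳ y)))
  powAdditive-^ a a-additive (suc k) = powAdditive-* {a} {a ^ k} a-additive (powAdditive-^ a a-additive k)

  powAdditive⇒pow-0# : ∀ e → PowAdditive e → pow 0# e ≡ 0#
  powAdditive⇒pow-0# e e-additive = x+x≈x⇒x≈0 _ (begin
    pow 0# e + pow 0# e   ≡⟨ sym (e-additive 0# 0#) ⟩
    pow (0# + 0#) e       ≡⟨ cong (λ z → pow z e) (+-identityʳ 0#) ⟩
    pow 0# e              ∎)

  powAdditive⇒pow-neg : ∀ e → PowAdditive e → ∀ x → pow (- x) e ≡ - pow x e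
  powAdditive⇒pow-neg e e-additive x = +-inverseˡ-unique _ _ (begin
    pow (- x) e + pow x e   ≡⟨ sym (e-additive (- x) x) ⟩
    pow (- x + x) e         ≡⟨ cong (λ z → pow z e) (-‿inverseˡ x) ⟩
    pow 0# e                ≡⟨ powAdditive⇒pow-0# e e-additive ⟩
    0#                      ∎)

  powAdditive⇒pow-Σᶠ : ∀ e → PowAdditive e → ∀ m (f : Fin m → Carrier) →
                       pow (Σᶠ m f) e ≡ Σᶠ m (λ i → pow (f i) e)
  powAdditive⇒pow-Σᶠ e e-additive zero    f = powAdditive⇒pow-0# e e-additive
  powAdditive⇒pow-Σᶠ e e-additive (suc m) f =
    trans (e-additive _ _) (cong (pow (f Fin.zero) e +_) (powAdditive⇒pow-Σᶠ e e-additive m (λ i → f (Fin.suc i))))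

  2∤m⇒m×1#≡1# : 1# + 1# ≡ 0# → ∀ m → ¬ 2 ∣ m → m ×ₙ 1# ≡ 1#
  2∤m⇒m×1#≡1# 2≡0 zero          2∤0     = ⊥-elim (2∤0 (divides 0 refl))
  2∤m⇒m×1#≡1# 2≡0 (suc zero)    _       = +-identityʳ 1#
  2∤m⇒m×1#≡1# 2≡0 (suc (suc m)) 2∤2+m = begin
    1# + (1# + m ×ₙ 1#)   ≡⟨ sym (+-assoc _ _ _) ⟩
    1# + 1# + m ×ₙ 1#     ≡⟨ cong (_+ m ×ₙ 1#) 2≡0 ⟩
    0# + m ×ₙ 1#          ≡⟨ +-identityˡ _ ⟩
    m ×ₙ 1#               ≡⟨ 2∤m⇒m×1#≡1# 2≡0 m (λ 2∣m → 2∤2+m (∣m∣n⇒∣m+n (∣-refl {2}) 2∣m)) ⟩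
    1#                    ∎

  1#+1#≢0 : ∀ {p} → p ×ₙ 1# ≡ 0# → ¬ 2 ∣ p → 1# + 1# ≢ 0#
  1#+1#≢0 {p} p×1#≡0 2∤p 2≡0 = 1≢0 (trans (sym (2∤m⇒m×1#≡1# 2≡0 p 2∤p)) p×1#≡0)

  ½*[x+x]≡x : 1# + 1# ≢ 0# → ∀ x → (1# + 1#) ⁻¹ * (x + x) ≡ x
  ½*[x+x]≡x 2≢0 x = begin
    (1# + 1#) ⁻¹ * (x + x)
      ≡⟨ cong ((1# + 1#) ⁻¹ *_) (solve 1 (λ x → x :+ x := (con 1 :+ con 1) :* x) refl x) ⟩
    (1# + 1#) ⁻¹ * ((1# + 1#) * x)
      ≡⟨ x⁻¹*[x*y]≡y 2≢0 x ⟩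
    x                               ∎

module Subfield {p s n : ℕ} (pp : Prime p) (1≤s : 1 ≤ s) (1≤n : 1 ≤ n)
                (L : FieldOfOrder ((p ^ s) ^ n)) where

  open FieldOfOrder L
  open FiniteField L
  open FieldTheory {p ^ s} {n} L
  open import Data.Fin.Properties using (any?; toℕ-inject₁; toℕ-fromℕ)
  open import Data.Product using (_,_; ∃)
  open import Relation.Nullary using (yes; no; _×-dec_)
  open import Relation.Binary.PropositionalEquality using (cong₂; module ≡-Reasoning)
  open ≡-Reasoning

  q : ℕ
  q = p ^ s

  p×1#≡0 : p ×ₙ 1# ≡ 0#
  p×1#≡0 = characteristic {p} {s ℕ.* n} (ℕ.^-*-assoc p s n)

  p≢2⇒1#+1#≢0 : p ≢ 2 → 1# + 1# ≢ 0#
  p≢2⇒1#+1#≢0 p≢2 = 1#+1#≢0 p×1#≡0 (prime≢2⇒2∤p pp p≢2)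

  q-additive : PowAdditive q
  q-additive = powAdditive-^ p (pow-+-prime pp p×1#≡0) s

  q^i-additive : ∀ i → PowAdditive (q ^ i)
  q^i-additive = powAdditive-^ q q-additive

  InK-0# : InK 0#
  InK-0# = powAdditive⇒pow-0# q q-additive

  InK-+ : ∀ {x y} → InK x → InK y → InK (x + y)
  InK-+ {x} {y} xᵠ≡x yᵠ≡y = trans (q-additive x y) (cong₂ _+_ xᵠ≡x yᵠ≡y)

  InK-* : ∀ {x y} → InK x → InK y → InK (x * y)
  InK-* {x} {y} xᵠ≡x yᵠ≡y = trans (pow-distrib-* x y q) (cong₂ _*_ xᵠ≡x yᵠ≡y)

  InK-neg : ∀ {x} → InK x → InK (- x)
  InK-neg {x} xᵠ≡x = trans (powAdditive⇒pow-neg q q-additive x) (cong -_ xᵠ≡x)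

  InK-⁻¹ : ∀ {x} → x ≢ 0# → InK x → InK (x ⁻¹)
  InK-⁻¹ {x} x≢0 xᵠ≡x = begin
    pow (x ⁻¹) q                     ≡⟨ sym (x⁻¹*[x*y]≡y x≢0 _) ⟩
    x ⁻¹ * (x * pow (x ⁻¹) q)        ≡⟨ cong (λ z → x ⁻¹ * (z * pow (x ⁻¹) q)) (sym xᵠ≡x) ⟩
    x ⁻¹ * (pow x q * pow (x ⁻¹) q)  ≡⟨ cong (x ⁻¹ *_) (sym (pow-distrib-* x (x ⁻¹) q)) ⟩
    x ⁻¹ * pow (x * x ⁻¹) q          ≡⟨ cong (λ z → x ⁻¹ * pow z q) (inverseʳ x x≢0) ⟩
    x ⁻¹ * pow 1# q                  ≡⟨ cong (x ⁻¹ *_) (pow-1# q) ⟩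
    x ⁻¹ * 1#                        ≡⟨ *-identityʳ _ ⟩
    x ⁻¹                             ∎

  InK-Σᶠ : ∀ m (f : Fin m → Carrier) → (∀ i → InK (f i)) → InK (Σᶠ m f)
  InK-Σᶠ zero    f f∈K = InK-0#
  InK-Σᶠ (suc m) f f∈K = InK-+ (f∈K Fin.zero) (InK-Σᶠ m (λ i → f (Fin.suc i)) (λ i → f∈K (Fin.suc i)))

  InK⇒pow-q^i : ∀ {k} → InK k → ∀ i → pow k (q ^ i) ≡ k
  InK⇒pow-q^i {k} kᵠ≡k zero    = *-identityʳ k
  InK⇒pow-q^i {k} kᵠ≡k (suc i) = begin
    pow k (q ℕ.* q ^ i)     ≡⟨ sym (pow-assocʳ k q (q ^ i)) ⟩
    pow (pow k q) (q ^ i)   ≡⟨ cong (λ z → pow z (q ^ i)) kᵠ≡k ⟩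
    pow k (q ^ i)           ≡⟨ InK⇒pow-q^i kᵠ≡k i ⟩
    k                       ∎

  Tr-+ : ∀ x y → Tr (x + y) ≡ Tr x + Tr y
  Tr-+ x y = trans (Σᶠ-cong n (λ i → q^i-additive (toℕ i) x y)) (Σᶠ-distrib-+ n _ _)

  Tr-0# : Tr 0# ≡ 0#
  Tr-0# = trans (Σᶠ-cong n (λ i → powAdditive⇒pow-0# (q ^ toℕ i) (q^i-additive (toℕ i)))) (Σᶠ-zero n)

  Tr-Σᶠ : ∀ m (f : Fin m → Carrier) → Tr (Σᶠ m f) ≡ Σᶠ m (λ i → Tr (f i))
  Tr-Σᶠ zero    f = Tr-0#
  Tr-Σᶠ (suc m) f = trans (Tr-+ _ _) (cong (Tr (f Fin.zero) +_) (Tr-Σᶠ m (λ i → f (Fin.suc i))))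

  Tr-* : ∀ {k} → InK k → ∀ x → Tr (k * x) ≡ k * Tr x
  Tr-* {k} k∈K x = begin
    Σᶠ n (λ i → pow (k * x) (q ^ toℕ i))
      ≡⟨ Σᶠ-cong n (λ i → pow-distrib-* k x (q ^ toℕ i)) ⟩
    Σᶠ n (λ i → pow k (q ^ toℕ i) * pow x (q ^ toℕ i))
      ≡⟨ Σᶠ-cong n (λ i → cong (_* _) (InK⇒pow-q^i k∈K (toℕ i))) ⟩
    Σᶠ n (λ i → k * pow x (q ^ toℕ i))
      ≡⟨ sym (*-distribˡ-Σᶠ n k _) ⟩
    k * Tr x ∎

  -- Raising to the q-th power shifts the conjugates x^(q^i) cyclically, as x^(q^n) = x.
  Tr-InK : ∀ x → InK (Tr x)
  Tr-InK x = begin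
    pow (Tr x) q                           ≡⟨ powAdditive⇒pow-Σᶠ q q-additive n _ ⟩
    Σᶠ n (λ i → pow (g (toℕ i)) q)         ≡⟨ Σᶠ-cong n (λ i → g-step (toℕ i)) ⟩
    Σᶠ n (λ i → g (suc (toℕ i)))           ≡⟨ Σᶠ-rotate n 1≤n g (trans (pow-N x) (sym (*-identityʳ x))) ⟩
    Tr x                                   ∎
    where
    g : ℕ → Carrier
    g k = pow x (q ^ k)
    g-step : ∀ k → pow (g k) q ≡ g (suc k)
    g-step k = trans (pow-assocʳ x (q ^ k) q) (cong (pow x) (ℕ.*-comm (q ^ k) q))

  frobeniusSum : ℕ → Carrier → Carrier
  frobeniusSum m x = Σᶠ m (λ i → pow x (q ^ toℕ i))

  q^-monoʳ-< : ∀ {m k} → m < k → q ^ m < q ^ k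
  q^-monoʳ-< = ℕ.^-monoʳ-< q (1<p^s pp 1≤s)

  frobeniusSum-monic : ∀ m → MonicOfDegree (q ^ m) (frobeniusSum (suc m))
  frobeniusSum-monic zero    = monic-cong (monic-pow 1) (λ x → sym (+-identityʳ _))
  frobeniusSum-monic (suc m) = monic-cong
    (monic-+ (q^-monoʳ-< (ℕ.n<1+n m)) (monic-pow (q ^ suc m)) (frobeniusSum-monic m))
    (λ x → trans (+-comm _ _) (sym (frobeniusSum-init-last x)))
    where
    frobeniusSum-init-last : ∀ x → frobeniusSum (suc (suc m)) x ≡ frobeniusSum (suc m) x + pow x (q ^ suc m)
    frobeniusSum-init-last x = trans (Σᶠ-init-last (suc m) (λ i → pow x (q ^ toℕ i)))
      (cong₂ _+_ (Σᶠ-cong (suc m) (λ i → cong (λ k → pow x (q ^ k)) (toℕ-inject₁ i)))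
                 (cong (λ k → pow x (q ^ k)) (toℕ-fromℕ (suc m))))

  -- Tr is a monic polynomial of degree q^(n-1) < q^n, so it cannot vanish on all q^n elements.
  Tr-nonvanishing : ¬ (∀ x → Tr x ≡ 0#)
  Tr-nonvanishing = frobeniusSum-nonvanishing n 1≤n ℕ.≤-refl
    where
    frobeniusSum-nonvanishing : ∀ m → 1 ≤ m → m ≤ n → ¬ (∀ x → frobeniusSum m x ≡ 0#)
    frobeniusSum-nonvanishing (suc m) _ 1+m≤n vanishes =
      <⇒≱ (q^-monoʳ-< 1+m≤n) (vanishing-monic⇒N≤degree (frobeniusSum-monic m) vanishes)

  IsSquareK⇒∃elem : ∀ {x} → IsSquareK x → ∃ λ k → InK (elem k) × (elem k * elem k ≡ x)
  IsSquareK⇒∃elem (b , b∈K , b*b≡x) =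
    index b , subst InK (sym (elem-index b)) b∈K , trans (cong (λ z → z * z) (elem-index b)) b*b≡x

  η₂-resp : ∀ {x y} → (IsSquareK x → IsSquareK y) → (IsSquareK y → IsSquareK x) → η₂ x ≡ η₂ y
  η₂-resp {x} {y} x⇒y y⇒x
    with any? (λ k → (pow (elem k) q ≟ elem k) ×-dec ((elem k * elem k) ≟ x))
       | any? (λ k → (pow (elem k) q ≟ elem k) ×-dec ((elem k * elem k) ≟ y))
  ... | yes _              | yes _ = refl
  ... | no _               | no _  = refl
  ... | yes (k , k∈K , sq) | no ¬y = ⊥-elim (¬y (IsSquareK⇒∃elem (x⇒y (elem k , k∈K , sq))))
  ... | no ¬x | yes (k , k∈K , sq) = ⊥-elim (¬x (IsSquareK⇒∃elem (y⇒x (elem k , k∈K , sq))))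

  η₂-*-square : ∀ x {t} → InK t → t ≢ 0# → η₂ (x * (t * t)) ≡ η₂ x
  η₂-*-square x {t} t∈K t≢0 = η₂-resp divide multiply
    where
    divide : IsSquareK (x * (t * t)) → IsSquareK x
    divide (b , b∈K , b*b≡xtt) = b * t ⁻¹ , InK-* b∈K (InK-⁻¹ t≢0 t∈K) , (begin
      b * t ⁻¹ * (b * t ⁻¹)
        ≡⟨ solve 2 (λ b t⁻¹ → b :* t⁻¹ :* (b :* t⁻¹) := t⁻¹ :* (t⁻¹ :* (b :* b))) refl b (t ⁻¹) ⟩
      t ⁻¹ * (t ⁻¹ * (b * b))
        ≡⟨ cong (λ z → t ⁻¹ * (t ⁻¹ * z)) b*b≡xtt ⟩
      t ⁻¹ * (t ⁻¹ * (x * (t * t)))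
        ≡⟨ cong (λ z → t ⁻¹ * (t ⁻¹ * z)) (solve 2 (λ x t → x :* (t :* t) := t :* (t :* x)) refl x t) ⟩
      t ⁻¹ * (t ⁻¹ * (t * (t * x)))
        ≡⟨ cong (t ⁻¹ *_) (x⁻¹*[x*y]≡y t≢0 (t * x)) ⟩
      t ⁻¹ * (t * x)
        ≡⟨ x⁻¹*[x*y]≡y t≢0 x ⟩
      x                                ∎)
    multiply : IsSquareK x → IsSquareK (x * (t * t))
    multiply (b , b∈K , b*b≡x) = b * t , InK-* b∈K t∈K ,
      trans (solve 2 (λ b t → b :* t :* (b :* t) := b :* b :* (t :* t)) refl b t) (cong (_* (t * t)) b*b≡x)

module TraceForm {p s n : ℕ} (pp : Prime p) (1≤s : 1 ≤ s) (1≤n : 1 ≤ n)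
                 (L : FieldOfOrder ((p ^ s) ^ n)) where

  open FieldOfOrder L
  open FiniteField L
  open FieldTheory {p ^ s} {n} L
  open Subfield pp 1≤s 1≤n L
  open import Data.Product using (_,_)
  open import Relation.Nullary using (yes; no)
  open import Relation.Binary.PropositionalEquality using (cong₂; module ≡-Reasoning)
  open ≡-Reasoning

  infixl 7 _·ᵥ_
  _·ᵥ_ : Mat → (Fin n → Carrier) → Fin n → Carrier
  (A ·ᵥ w) i = Σᶠ n (λ k → A i k * w k)

  Id-·ᵥ : ∀ w i → (Id ·ᵥ w) i ≡ w i
  Id-·ᵥ w i = trans (Σᶠ-single n _ i off-diagonal) on-diagonal
    where
    off-diagonal : ∀ k → k ≢ i → Id i k * w k ≡ 0#
    off-diagonal k k≢i with i Fin.≟ k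
    ... | yes i≡k = ⊥-elim (k≢i (sym i≡k))
    ... | no  _   = zeroˡ (w k)
    on-diagonal : Id i i * w i ≡ w i
    on-diagonal with i Fin.≟ i
    ... | yes _   = *-identityˡ (w i)
    ... | no  i≢i = ⊥-elim (i≢i refl)

  ·-·ᵥ-assoc : ∀ A B w i → ((A · B) ·ᵥ w) i ≡ (A ·ᵥ (B ·ᵥ w)) i
  ·-·ᵥ-assoc A B w i = begin
    Σᶠ n (λ k → Σᶠ n (λ l → A i l * B l k) * w k)     ≡⟨ Σᶠ-cong n (λ k → *-distribʳ-Σᶠ n (w k) _) ⟩
    Σᶠ n (λ k → Σᶠ n (λ l → A i l * B l k * w k))     ≡⟨ Σᶠ-swap n n _ ⟩
    Σᶠ n (λ l → Σᶠ n (λ k → A i l * B l k * w k))     ≡⟨ Σᶠ-cong n (λ l → Σᶠ-cong n (λ k → *-assoc _ _ _)) ⟩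
    Σᶠ n (λ l → Σᶠ n (λ k → A i l * (B l k * w k)))   ≡⟨ Σᶠ-cong n (λ l → sym (*-distribˡ-Σᶠ n (A i l) _)) ⟩
    Σᶠ n (λ l → A i l * (B ·ᵥ w) l)                   ∎

  ·ᵥ-zero : ∀ A i → (A ·ᵥ (λ _ → 0#)) i ≡ 0#
  ·ᵥ-zero A i = trans (Σᶠ-cong n (λ k → zeroʳ (A i k))) (Σᶠ-zero n)

  InGL⇒·ᵥ-injective : ∀ {M} → InGL M → ∀ w → (∀ i → (M ·ᵥ w) i ≡ 0#) → ∀ j → w j ≡ 0#
  InGL⇒·ᵥ-injective (_ , M⁻¹ , _ , _ , M⁻¹·M≐Id) w Mw≡0 j = begin
    w j                       ≡⟨ sym (Id-·ᵥ w j) ⟩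
    (Id ·ᵥ w) j               ≡⟨ Σᶠ-cong n (λ k → cong (_* w k) (sym (M⁻¹·M≐Id j k))) ⟩
    ((M⁻¹ · _) ·ᵥ w) j        ≡⟨ ·-·ᵥ-assoc M⁻¹ _ w j ⟩
    (M⁻¹ ·ᵥ (_ ·ᵥ w)) j       ≡⟨ Σᶠ-cong n (λ k → cong (M⁻¹ j k *_) (Mw≡0 k)) ⟩
    (M⁻¹ ·ᵥ (λ _ → 0#)) j     ≡⟨ ·ᵥ-zero M⁻¹ j ⟩
    0#                        ∎

  Tr-*-nonvanishing : ∀ {d} → d ≢ 0# → ¬ (∀ x → Tr (d * x) ≡ 0#)
  Tr-*-nonvanishing {d} d≢0 vanishes =
    Tr-nonvanishing (λ x → trans (cong Tr (sym (x*[x⁻¹*y]≡y d≢0 x))) (vanishes (d ⁻¹ * x)))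

  Tr-*-vanishing-on-basis : ∀ {v} → IsBasis v → ∀ d → (∀ k → Tr (d * v k) ≡ 0#) → ∀ x → Tr (d * x) ≡ 0#
  Tr-*-vanishing-on-basis {v} (spanning , _) d vanishes x with spanning x
  ... | b , b∈K , Σbv≡x = begin
    Tr (d * x)
      ≡⟨ cong (λ z → Tr (d * z)) (sym Σbv≡x) ⟩
    Tr (d * Σᶠ n (λ k → b k * v k))
      ≡⟨ cong Tr (*-distribˡ-Σᶠ n d _) ⟩
    Tr (Σᶠ n (λ k → d * (b k * v k)))
      ≡⟨ Tr-Σᶠ n _ ⟩
    Σᶠ n (λ k → Tr (d * (b k * v k)))
      ≡⟨ Σᶠ-cong n (λ k → cong Tr (solve 3 (λ d b v → d :* (b :* v) := b :* (d :* v)) refl d (b k) (v k))) ⟩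
    Σᶠ n (λ k → Tr (b k * (d * v k)))
      ≡⟨ Σᶠ-cong n (λ k → trans (Tr-* (b∈K k) _) (trans (cong (b k *_) (vanishes k)) (zeroʳ _))) ⟩
    Σᶠ n (λ _ → 0#)
      ≡⟨ Σᶠ-zero n ⟩
    0# ∎

  traceVector : (Fin n → Carrier) → Carrier → Fin n → Carrier
  traceVector v d k = Tr (d * v k)

  -- Entry i is Tr (d wᵢ) for the basis wᵢ = Σₖ Mᵢₖ vₖ, so these vanish only if Tr (d ·) does.
  traceCoordinates-nonzero : ∀ {v M d} → IsBasis v → InGL M → d ≢ 0# → ¬ (∀ i → (M ·ᵥ traceVector v d) i ≡ 0#)
  traceCoordinates-nonzero {v} {M} {d} basis M∈GL d≢0 vanishes =
    Tr-*-nonvanishing d≢0 (Tr-*-vanishing-on-basis basis d (InGL⇒·ᵥ-injective M∈GL (traceVector v d) vanishes))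

  traceCoordinates-+ : ∀ v M d e i →
    (M ·ᵥ traceVector v (d + e)) i ≡ (M ·ᵥ traceVector v d) i + (M ·ᵥ traceVector v e) i
  traceCoordinates-+ v M d e i = begin
    Σᶠ n (λ j → M i j * Tr ((d + e) * v j))
      ≡⟨ Σᶠ-cong n (λ j → cong (λ z → M i j * Tr z) (distribʳ (v j) d e)) ⟩
    Σᶠ n (λ j → M i j * Tr (d * v j + e * v j))
      ≡⟨ Σᶠ-cong n (λ j → trans (cong (M i j *_) (Tr-+ _ _)) (distribˡ _ _ _)) ⟩
    Σᶠ n (λ j → M i j * Tr (d * v j) + M i j * Tr (e * v j))
      ≡⟨ Σᶠ-distrib-+ n _ _ ⟩
    (M ·ᵥ traceVector v d) i + (M ·ᵥ traceVector v e) i ∎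

  traceCoordinates-* : ∀ v M {k} → InK k → ∀ d i → (M ·ᵥ traceVector v (k * d)) i ≡ k * (M ·ᵥ traceVector v d) i
  traceCoordinates-* v M {k} k∈K d i = begin
    Σᶠ n (λ j → M i j * Tr (k * d * v j))
      ≡⟨ Σᶠ-cong n (λ j → cong (λ z → M i j * Tr z) (*-assoc k d (v j))) ⟩
    Σᶠ n (λ j → M i j * Tr (k * (d * v j)))
      ≡⟨ Σᶠ-cong n (λ j → cong (M i j *_) (Tr-* k∈K _)) ⟩
    Σᶠ n (λ j → M i j * (k * Tr (d * v j)))
      ≡⟨ Σᶠ-cong n (λ j → solve 3 (λ m k t → m :* (k :* t) := k :* (m :* t)) refl (M i j) k _) ⟩
    Σᶠ n (λ j → k * (M i j * Tr (d * v j)))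
      ≡⟨ sym (*-distribˡ-Σᶠ n k _) ⟩
    k * (M ·ᵥ traceVector v d) i ∎

  Qc≡Tr*Tr : ∀ c x → Qc c x ≡ Tr x * Tr (c * x)
  Qc≡Tr*Tr c x = trans (cong Tr (*-comm (c * x) (Tr x))) (Tr-* (Tr-InK x) (c * x))

  [a+b][c+d]-ac-bd≡ad+bc : ∀ a b c d → (a + b) * (c + d) - a * c - b * d ≡ a * d + b * c
  [a+b][c+d]-ac-bd≡ad+bc a b c d = begin
    (a + b) * (c + d) + - (a * c) + - (b * d)
      ≡⟨ solve 6 (λ a b c d -ac -bd → (a :+ b) :* (c :+ d) :+ -ac :+ -bd
                                      := a :* d :+ b :* c :+ (a :* c :+ -ac) :+ (b :* d :+ -bd))
               refl a b c d (- (a * c)) (- (b * d)) ⟩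
    a * d + b * c + (a * c - a * c) + (b * d - b * d)
      ≡⟨ cong₂ (λ z w → a * d + b * c + z + w) (-‿inverseʳ _) (-‿inverseʳ _) ⟩
    a * d + b * c + 0# + 0#
      ≡⟨ trans (+-identityʳ _) (+-identityʳ _) ⟩
    a * d + b * c ∎

  Hmat-entry : 1# + 1# ≢ 0# → ∀ c v i j →
    Hmat c v i j ≡ half * (Tr (v i) * Tr (c * v j) + Tr (v j) * Tr (c * v i))
  Hmat-entry 2≢0 c v i j with i Fin.≟ j
  ... | yes refl = trans (Qc≡Tr*Tr c (v i)) (sym (½*[x+x]≡x 2≢0 _))
  ... | no  _    = cong (half *_) (begin
    Qc c (v i + v j) - Qc c (v i) - Qc c (v j)
      ≡⟨ cong₂ (λ a b → a - b - Qc c (v j)) (Qc≡Tr*Tr c _) (Qc≡Tr*Tr c _) ⟩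
    Tr (v i + v j) * Tr (c * (v i + v j)) - Tr (v i) * Tr (c * v i) - Qc c (v j)
      ≡⟨ cong₂ (λ a b → a - Tr (v i) * Tr (c * v i) - b)
               (cong₂ _*_ (Tr-+ _ _) (trans (cong Tr (distribˡ c (v i) (v j))) (Tr-+ _ _))) (Qc≡Tr*Tr c _) ⟩
    (Tr (v i) + Tr (v j)) * (Tr (c * v i) + Tr (c * v j)) - Tr (v i) * Tr (c * v i) - Tr (v j) * Tr (c * v j)
      ≡⟨ [a+b][c+d]-ac-bd≡ad+bc _ _ _ _ ⟩
    Tr (v i) * Tr (c * v j) + Tr (v j) * Tr (c * v i) ∎)

  congruence-symmetrized : ∀ M H h (x y : Fin n → Carrier) → (∀ k m → H k m ≡ h * (x k * y m + x m * y k)) →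
    ∀ i j → (M · H · M ᵀ) i j ≡ h * ((M ·ᵥ x) i * (M ·ᵥ y) j + (M ·ᵥ x) j * (M ·ᵥ y) i)
  congruence-symmetrized M H h x y H-entry i j = begin
    Σᶠ n (λ m → Σᶠ n (λ k → M i k * H k m) * M j m)
      ≡⟨ Σᶠ-cong n (λ m → *-distribʳ-Σᶠ n (M j m) _) ⟩
    Σᶠ n (λ m → Σᶠ n (λ k → M i k * H k m * M j m))
      ≡⟨ Σᶠ-cong n (λ m → Σᶠ-cong n (λ k → regroup k m)) ⟩
    Σᶠ n (λ m → Σᶠ n (λ k → h * (Mx k * My′ m + My k * Mx′ m)))
      ≡⟨ Σᶠ-cong n (λ m → trans (sym (*-distribˡ-Σᶠ n h _)) (cong (h *_) (Σᶠ-distrib-+ n _ _))) ⟩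
    Σᶠ n (λ m → h * (Σᶠ n (λ k → Mx k * My′ m) + Σᶠ n (λ k → My k * Mx′ m)))
      ≡⟨ trans (sym (*-distribˡ-Σᶠ n h _)) (cong (h *_) (Σᶠ-distrib-+ n _ _)) ⟩
    h * (Σᶠ n (λ m → Σᶠ n (λ k → Mx k * My′ m)) + Σᶠ n (λ m → Σᶠ n (λ k → My k * Mx′ m)))
      ≡⟨ cong (h *_) (cong₂ _+_ (Σᶠ-product n Mx My′) (Σᶠ-product n My Mx′)) ⟩
    h * ((M ·ᵥ x) i * (M ·ᵥ y) j + (M ·ᵥ y) i * (M ·ᵥ x) j)
      ≡⟨ cong (λ z → h * ((M ·ᵥ x) i * (M ·ᵥ y) j + z)) (*-comm _ _) ⟩
    h * ((M ·ᵥ x) i * (M ·ᵥ y) j + (M ·ᵥ x) j * (M ·ᵥ y) i) ∎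
    where
    Mx My Mx′ My′ : Fin n → Carrier
    Mx  k = M i k * x k
    My  k = M i k * y k
    Mx′ m = M j m * x m
    My′ m = M j m * y m
    regroup : ∀ k m → M i k * H k m * M j m ≡ h * (Mx k * My′ m + My k * Mx′ m)
    regroup k m = trans (cong (λ z → M i k * z * M j m) (H-entry k m))
      (solve 7 (λ a h xk ym xm yk b → a :* (h :* (xk :* ym :+ xm :* yk)) :* b
                                    := h :* ((a :* xk) :* (b :* ym) :+ (a :* yk) :* (b :* xm)))
             refl (M i k) h (x k) (y m) (x m) (y k) (M j m))

  traceCoordinates-InK : ∀ {v M} → KMat M → ∀ d i → InK ((M ·ᵥ traceVector v d) i)
  traceCoordinates-InK M∈K d i = InK-Σᶠ n _ (λ k → InK-* (M∈K i k) (Tr-InK _))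

  traceCoordinates-proportional : ∀ {c} v M → InK c → ∀ i → (M ·ᵥ traceVector v c) i ≡ c * (M ·ᵥ traceVector v 1#) i
  traceCoordinates-proportional {c} v M c∈K i =
    trans (cong (λ d → (M ·ᵥ traceVector v d) i) (sym (*-identityʳ c))) (traceCoordinates-* v M c∈K 1# i)

  -- The coordinates are K-linear in d, and c - k ≢ 0 for k ∈ K.
  traceCoordinates-independent : ∀ {v M c} → IsBasis v → InGL M → ¬ InK c →
    ∀ k → InK k → ¬ (∀ i → (M ·ᵥ traceVector v c) i ≡ k * (M ·ᵥ traceVector v 1#) i)
  traceCoordinates-independent {v} {M} {c} basis M∈GL c∉K k k∈K proportional =
    traceCoordinates-nonzero basis M∈GL c-k≢0 (λ i → begin
      (M ·ᵥ traceVector v (c + - k * 1#)) i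
        ≡⟨ traceCoordinates-+ v M c (- k * 1#) i ⟩
      (M ·ᵥ traceVector v c) i + (M ·ᵥ traceVector v (- k * 1#)) i
        ≡⟨ cong₂ _+_ (proportional i) (traceCoordinates-* v M (InK-neg k∈K) 1# i) ⟩
      k * (M ·ᵥ traceVector v 1#) i + - k * (M ·ᵥ traceVector v 1#) i
        ≡⟨ sym (distribʳ _ k (- k)) ⟩
      (k + - k) * (M ·ᵥ traceVector v 1#) i
        ≡⟨ cong (_* (M ·ᵥ traceVector v 1#) i) (-‿inverseʳ k) ⟩
      0# * (M ·ᵥ traceVector v 1#) i
        ≡⟨ zeroˡ _ ⟩
      0# ∎)
    where
    c-k≢0 : c + - k * 1# ≢ 0#
    c-k≢0 c-k≡0 = c∉K (subst InK (sym c≡k) k∈K)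
      where
      c≡k : c ≡ k
      c≡k = begin
        c              ≡⟨ +-inverseˡ-unique c _ c-k≡0 ⟩
        - (- k * 1#)   ≡⟨ cong -_ (*-identityʳ (- k)) ⟩
        - - k          ≡⟨ -‿involutive k ⟩
        k              ∎

  diag-diagonal : ∀ d i → diag d i i ≡ d i
  diag-diagonal d i with i Fin.≟ i
  ... | yes _   = refl
  ... | no  i≢i = ⊥-elim (i≢i refl)

  diag-off-diagonal : ∀ d {i j} → i ≢ j → diag d i j ≡ 0#
  diag-off-diagonal d {i} {j} i≢j with i Fin.≟ j
  ... | yes i≡j = ⊥-elim (i≢j i≡j)
  ... | no  _   = refl

  module Diagonalized (2≢0 : 1# + 1# ≢ 0#) (c : Carrier) (v : Fin n → Carrier) (M : Mat)
                      (a : Fin n → Carrier) (MHMᵀ≐diag : (M · Hmat c v · M ᵀ) ≐ diag a) where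

    t u : Fin n → Carrier
    t = M ·ᵥ traceVector v 1#
    u = M ·ᵥ traceVector v c

    entry : ∀ i j → (M · Hmat c v · M ᵀ) i j ≡ half * (t i * u j + t j * u i)
    entry = congruence-symmetrized M (Hmat c v) half (traceVector v 1#) (traceVector v c) H-entry
      where
      H-entry : ∀ k m → Hmat c v k m ≡
                half * (traceVector v 1# k * traceVector v c m + traceVector v 1# m * traceVector v c k)
      H-entry k m rewrite *-identityˡ (v k) | *-identityˡ (v m) = Hmat-entry 2≢0 c v k m

    diagonal : ∀ i → t i * u i ≡ a i
    diagonal i = begin
      t i * u i                        ≡⟨ sym (½*[x+x]≡x 2≢0 _) ⟩
      half * (t i * u i + t i * u i)   ≡⟨ sym (entry i i) ⟩
      (M · Hmat c v · M ᵀ) i i         ≡⟨ MHMᵀ≐diag i i ⟩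
      diag a i i                       ≡⟨ diag-diagonal a i ⟩
      a i                              ∎

    off-diagonal : ∀ i j → i ≢ j → t i * u j + t j * u i ≡ 0#
    off-diagonal i j i≢j = x≢0∧x*y≡0⇒y≡0 (⁻¹-nonzero 2≢0) (begin
      half * (t i * u j + t j * u i)   ≡⟨ sym (entry i j) ⟩
      (M · Hmat c v · M ᵀ) i j         ≡⟨ MHMᵀ≐diag i j ⟩
      diag a i j                       ≡⟨ diag-off-diagonal a i≢j ⟩
      0#                               ∎)

module RankTwo {p s n : ℕ} (pp : Prime p) (1≤s : 1 ≤ s) (1≤n : 1 ≤ n)
               (L : FieldOfOrder ((p ^ s) ^ n)) where

  open FieldOfOrder L
  open FiniteField L
  open FieldTheory {p ^ s} {n} L
  open Subfield pp 1≤s 1≤n L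
  open import Data.Product using (_,_; proj₁; proj₂)
  open import Data.Fin.Properties using (any?)
  open import Relation.Nullary using (yes; no; ¬?)
  open import Relation.Nullary.Decidable using (decidable-stable)
  open import Relation.Binary.PropositionalEquality using (cong₂; module ≡-Reasoning)
  open ≡-Reasoning

  module Symmetrized (2≢0 : 1# + 1# ≢ 0#) (t u a : Fin n → Carrier)
                     (t∈K : ∀ i → InK (t i)) (u∈K : ∀ i → InK (u i))
                     (diagonal : ∀ i → t i * u i ≡ a i)
                     (off-diagonal : ∀ i j → i ≢ j → t i * u j + t j * u i ≡ 0#) where

    a≢0⇒t≢0 : ∀ {i} → a i ≢ 0# → t i ≢ 0#
    a≢0⇒t≢0 {i} aᵢ≢0 tᵢ≡0 = aᵢ≢0 (trans (sym (diagonal i)) (trans (cong (_* u i) tᵢ≡0) (zeroˡ _)))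

    a≢0⇒u≢0 : ∀ {i} → a i ≢ 0# → u i ≢ 0#
    a≢0⇒u≢0 {i} aᵢ≢0 uᵢ≡0 = aᵢ≢0 (trans (sym (diagonal i)) (trans (cong (t i *_) uᵢ≡0) (zeroʳ _)))

    tᵢuⱼ≡-tⱼuᵢ : ∀ {i j} → i ≢ j → t i * u j ≡ - (t j * u i)
    tᵢuⱼ≡-tⱼuᵢ {i} {j} i≢j = +-inverseˡ-unique _ _ (off-diagonal i j i≢j)

    a≡0-beside-nonzero : ∀ {i j} → i ≢ j → a i ≢ 0# → a j ≡ 0# → t j ≡ 0# × u j ≡ 0#
    a≡0-beside-nonzero {i} {j} i≢j aᵢ≢0 aⱼ≡0 = tⱼ≡0 , uⱼ≡0
      where
      tⱼ≡0 : t j ≡ 0#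
      tⱼ≡0 = x*x≡0⇒x≡0 (x≢0∧x*y≡0⇒y≡0 (a≢0⇒u≢0 aᵢ≢0) (begin
        u i * (t j * t j)
          ≡⟨ solve 2 (λ uᵢ tⱼ → uᵢ :* (tⱼ :* tⱼ) := tⱼ :* (tⱼ :* uᵢ)) refl (u i) (t j) ⟩
        t j * (t j * u i)
          ≡⟨ cong (t j *_) (tᵢuⱼ≡-tⱼuᵢ (λ j≡i → i≢j (sym j≡i))) ⟩
        t j * - (t i * u j)
          ≡⟨ sym (-‿distribʳ-* (t j) _) ⟩
        - (t j * (t i * u j))
          ≡⟨ cong -_ (solve 3 (λ tⱼ tᵢ uⱼ → tⱼ :* (tᵢ :* uⱼ) := tᵢ :* (tⱼ :* uⱼ)) refl (t j) (t i) (u j)) ⟩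
        - (t i * (t j * u j))
          ≡⟨ cong (λ z → - (t i * z)) (trans (diagonal j) aⱼ≡0) ⟩
        - (t i * 0#)
          ≡⟨ cong -_ (zeroʳ (t i)) ⟩
        - 0#
          ≡⟨ -0#≈0# ⟩
        0# ∎))
      uⱼ≡0 : u j ≡ 0#
      uⱼ≡0 = x≢0∧x*y≡0⇒y≡0 (a≢0⇒t≢0 aᵢ≢0) (begin
        t i * u j                ≡⟨ tᵢuⱼ≡-tⱼuᵢ i≢j ⟩
        - (t j * u i)            ≡⟨ cong (λ z → - (z * u i)) tⱼ≡0 ⟩
        - (0# * u i)             ≡⟨ cong -_ (zeroˡ (u i)) ⟩
        - 0#                     ≡⟨ -0#≈0# ⟩
        0#                       ∎)

    -- If some tᵢ ≢ 0 then uᵢ = 0 on the diagonal, and the off-diagonal relations force every uⱼ = 0.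
    a≡0⇒t≡0⊎u≡0 : (∀ i → a i ≡ 0#) → (∀ i → t i ≡ 0#) ⊎ (∀ i → u i ≡ 0#)
    a≡0⇒t≡0⊎u≡0 a≡0 with any? (λ i → ¬? (t i ≟ 0#))
    ... | no ∄tᵢ≢0 = inj₁ (λ i → decidable-stable (t i ≟ 0#) (λ tᵢ≢0 → ∄tᵢ≢0 (i , tᵢ≢0)))
    ... | yes (i , tᵢ≢0) = inj₂ u≡0
      where
      uᵢ≡0 : u i ≡ 0#
      uᵢ≡0 = x≢0∧x*y≡0⇒y≡0 tᵢ≢0 (trans (diagonal i) (a≡0 i))
      u≡0 : ∀ j → u j ≡ 0#
      u≡0 j with i Fin.≟ j
      ... | yes refl = uᵢ≡0
      ... | no i≢j   = x≢0∧x*y≡0⇒y≡0 tᵢ≢0 (begin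
        t i * u j                ≡⟨ tᵢuⱼ≡-tⱼuᵢ i≢j ⟩
        - (t j * u i)            ≡⟨ cong (λ z → - (t j * z)) uᵢ≡0 ⟩
        - (t j * 0#)             ≡⟨ cong -_ (zeroʳ (t j)) ⟩
        - 0#                     ≡⟨ -0#≈0# ⟩
        0#                       ∎)

    rank-one⇒proportional : ∀ {i} → a i ≢ 0# → (∀ j → j ≢ i → a j ≡ 0#) → ∀ j → u j ≡ u i * t i ⁻¹ * t j
    rank-one⇒proportional {i} aᵢ≢0 a≡0 j with j Fin.≟ i
    ... | yes refl = begin
      u i                      ≡⟨ sym (*-identityʳ (u i)) ⟩
      u i * 1#                 ≡⟨ cong (u i *_) (sym (inverseˡ (t i) (a≢0⇒t≢0 aᵢ≢0))) ⟩
      u i * (t i ⁻¹ * t i)     ≡⟨ sym (*-assoc _ _ _) ⟩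
      u i * t i ⁻¹ * t i       ∎
    ... | no j≢i = begin
      u j                      ≡⟨ proj₂ zero-at-j ⟩
      0#                       ≡⟨ sym (zeroʳ _) ⟩
      u i * t i ⁻¹ * 0#        ≡⟨ cong (u i * t i ⁻¹ *_) (sym (proj₁ zero-at-j)) ⟩
      u i * t i ⁻¹ * t j       ∎
      where
      zero-at-j : t j ≡ 0# × u j ≡ 0#
      zero-at-j = a≡0-beside-nonzero (λ i≡j → j≢i (sym i≡j)) aᵢ≢0 (a≡0 j j≢i)

    -- The three off-diagonal relations turn P = (tᵢuⱼ)(tⱼuₖ)(tₖuᵢ) into -P.
    three-nonzero-impossible : ∀ {i j k} → i ≢ j → j ≢ k → k ≢ i → a i ≢ 0# → a j ≢ 0# → a k ≢ 0# → ⊥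
    three-nonzero-impossible {i} {j} {k} i≢j j≢k k≢i aᵢ≢0 aⱼ≢0 aₖ≢0 = P≢0 (x≡-x⇒x≡0 2≢0 (begin
      P
        ≡⟨ cong₂ (λ x y → x * y * (t k * u i)) (tᵢuⱼ≡-tⱼuᵢ i≢j) (tᵢuⱼ≡-tⱼuᵢ j≢k) ⟩
      - (t j * u i) * - (t k * u j) * (t k * u i)
        ≡⟨ cong (λ z → - (t j * u i) * - (t k * u j) * z) (tᵢuⱼ≡-tⱼuᵢ k≢i) ⟩
      - (t j * u i) * - (t k * u j) * - (t i * u k)
        ≡⟨ -x*-y*-z≡-[x*y*z] _ _ _ ⟩
      - (t j * u i * (t k * u j) * (t i * u k))
        ≡⟨ cong -_ (solve 6 (λ tᵢ tⱼ tₖ uᵢ uⱼ uₖ → tⱼ :* uᵢ :* (tₖ :* uⱼ) :* (tᵢ :* uₖ)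
                                               := tᵢ :* uⱼ :* (tⱼ :* uₖ) :* (tₖ :* uᵢ))
                            refl (t i) (t j) (t k) (u i) (u j) (u k)) ⟩
      - P ∎))
      where
      P : Carrier
      P = t i * u j * (t j * u k) * (t k * u i)
      P≢0 : P ≢ 0#
      P≢0 = *-nonzero (*-nonzero (*-nonzero (a≢0⇒t≢0 aᵢ≢0) (a≢0⇒u≢0 aⱼ≢0))
                                 (*-nonzero (a≢0⇒t≢0 aⱼ≢0) (a≢0⇒u≢0 aₖ≢0)))
                      (*-nonzero (a≢0⇒t≢0 aₖ≢0) (a≢0⇒u≢0 aᵢ≢0))

    aᵢaⱼ≡-1*square : ∀ {i j} → i ≢ j → a i * a j ≡ - 1# * (t i * u j * (t i * u j))
    aᵢaⱼ≡-1*square {i} {j} i≢j = begin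
      a i * a j
        ≡⟨ sym (cong₂ _*_ (diagonal i) (diagonal j)) ⟩
      t i * u i * (t j * u j)
        ≡⟨ solve 4 (λ tᵢ uᵢ tⱼ uⱼ → tᵢ :* uᵢ :* (tⱼ :* uⱼ) := tᵢ :* uⱼ :* (tⱼ :* uᵢ))
                   refl (t i) (u i) (t j) (u j) ⟩
      t i * u j * (t j * u i)
        ≡⟨ cong (t i * u j *_) (tᵢuⱼ≡-tⱼuᵢ (λ j≡i → i≢j (sym j≡i))) ⟩
      t i * u j * - (t i * u j)
        ≡⟨ cong (t i * u j *_) (sym (-1*x≈-x _)) ⟩
      t i * u j * (- 1# * (t i * u j))
        ≡⟨ solve 2 (λ x m → x :* (m :* x) := m :* (x :* x)) refl (t i * u j) (- 1#) ⟩
      - 1# * (t i * u j * (t i * u j)) ∎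

    two-nonzero-impossible-if-proportional : ∀ {c} → c ≢ 0# → (∀ i → u i ≡ c * t i) →
                                             ∀ {i j} → i ≢ j → a i ≢ 0# → a j ≢ 0# → ⊥
    two-nonzero-impossible-if-proportional {c} c≢0 u≡ct {i} {j} i≢j aᵢ≢0 aⱼ≢0 =
      *-nonzero 2≢0 (*-nonzero c≢0 (*-nonzero (a≢0⇒t≢0 aᵢ≢0) (a≢0⇒t≢0 aⱼ≢0))) (begin
        (1# + 1#) * (c * (t i * t j))
          ≡⟨ solve 3 (λ c tᵢ tⱼ → (con 1 :+ con 1) :* (c :* (tᵢ :* tⱼ)) := tᵢ :* (c :* tⱼ) :+ tⱼ :* (c :* tᵢ))
                     refl c (t i) (t j) ⟩
        t i * (c * t j) + t j * (c * t i)
          ≡⟨ sym (cong₂ (λ x y → t i * x + t j * y) (u≡ct j) (u≡ct i)) ⟩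
        t i * u j + t j * u i
          ≡⟨ off-diagonal i j i≢j ⟩
        0# ∎)

    a≡c*t*t : ∀ {c} → (∀ i → u i ≡ c * t i) → ∀ i → a i ≡ c * (t i * t i)
    a≡c*t*t {c} u≡ct i = trans (sym (diagonal i))
      (trans (cong (t i *_) (u≡ct i)) (solve 2 (λ tᵢ c → tᵢ :* (c :* tᵢ) := c :* (tᵢ :* tᵢ)) refl (t i) c))

    LeadingNonzero : ℕ → Set
    LeadingNonzero l = ∀ i → toℕ i < l → InK (a i) × (a i ≢ 0#)

    TrailingZero : ℕ → Set
    TrailingZero l = ∀ i → l ≤ toℕ i → a i ≡ 0#

    leading-nonzero : ∀ {l} (l≤n : l ≤ n) → LeadingNonzero l → ∀ i → a (inject≤ i l≤n) ≢ 0#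
    leading-nonzero l≤n leading i = proj₂ (leading _ (subst (_< _) (sym (toℕ-inject≤ i l≤n)) (toℕ<n i)))

    η₂δ-proportional : ∀ {c} → InK c → c ≢ 0# → (∀ i → u i ≡ c * t i) → ¬ (∀ i → t i ≡ 0#) →
      ∀ l (l≤n : l ≤ n) → LeadingNonzero l → TrailingZero l → η₂ (Πᶠ l (λ i → a (inject≤ i l≤n))) ≡ η₂ c
    η₂δ-proportional c∈K c≢0 u≡ct t≢0 zero l≤n _ trailing = ⊥-elim (t≢0 (λ i →
      x*x≡0⇒x≡0 (x≢0∧x*y≡0⇒y≡0 c≢0 (trans (sym (a≡c*t*t u≡ct i)) (trailing i ℕ.z≤n)))))
    η₂δ-proportional {c} c∈K c≢0 u≡ct t≢0 (suc zero) l≤n leading _ = begin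
      η₂ (a i₀ * 1#)             ≡⟨ cong η₂ (trans (*-identityʳ _) (a≡c*t*t u≡ct i₀)) ⟩
      η₂ (c * (t i₀ * t i₀))     ≡⟨ η₂-*-square c (t∈K i₀) (a≢0⇒t≢0 (leading-nonzero l≤n leading Fin.zero)) ⟩
      η₂ c                       ∎
      where
      i₀ : Fin n
      i₀ = inject≤ Fin.zero l≤n
    η₂δ-proportional c∈K c≢0 u≡ct t≢0 (suc (suc l)) l≤n leading _ =
      ⊥-elim (two-nonzero-impossible-if-proportional c≢0 u≡ct (inject≤-≢ l≤n (λ ()))
                (leading-nonzero l≤n leading Fin.zero) (leading-nonzero l≤n leading (Fin.suc Fin.zero)))

    η₂δ-independent : ¬ (∀ i → t i ≡ 0#) → ¬ (∀ i → u i ≡ 0#) → (∀ k → InK k → ¬ (∀ i → u i ≡ k * t i)) →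
      ∀ l (l≤n : l ≤ n) → LeadingNonzero l → TrailingZero l → η₂ (Πᶠ l (λ i → a (inject≤ i l≤n))) ≡ η₂ (- 1#)
    η₂δ-independent t≢0 u≢0 independent zero l≤n _ trailing =
      ⊥-elim ([ t≢0 , u≢0 ]′ (a≡0⇒t≡0⊎u≡0 (λ i → trailing i ℕ.z≤n)))
    η₂δ-independent t≢0 u≢0 independent (suc zero) l≤n leading trailing =
      ⊥-elim (independent (u i₀ * t i₀ ⁻¹) (InK-* (u∈K i₀) (InK-⁻¹ tᵢ₀≢0 (t∈K i₀)))
                (rank-one⇒proportional aᵢ₀≢0 (λ j j≢i₀ → trailing j (≢inject≤-zero⇒1≤toℕ l≤n j≢i₀))))
      where
      i₀ : Fin n
      i₀ = inject≤ Fin.zero l≤n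
      aᵢ₀≢0 : a i₀ ≢ 0#
      aᵢ₀≢0 = leading-nonzero l≤n leading Fin.zero
      tᵢ₀≢0 : t i₀ ≢ 0#
      tᵢ₀≢0 = a≢0⇒t≢0 aᵢ₀≢0
    η₂δ-independent t≢0 u≢0 independent (suc (suc zero)) l≤n leading _ = begin
      η₂ (a i₀ * (a i₁ * 1#))
        ≡⟨ cong η₂ (trans (cong (a i₀ *_) (*-identityʳ _)) (aᵢaⱼ≡-1*square (inject≤-≢ l≤n (λ ())))) ⟩
      η₂ (- 1# * (t i₀ * u i₁ * (t i₀ * u i₁)))
        ≡⟨ η₂-*-square (- 1#) (InK-* (t∈K i₀) (u∈K i₁)) tᵢ₀uᵢ₁≢0 ⟩
      η₂ (- 1#) ∎
      where
      i₀ i₁ : Fin n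
      i₀ = inject≤ Fin.zero l≤n
      i₁ = inject≤ (Fin.suc Fin.zero) l≤n
      tᵢ₀uᵢ₁≢0 : t i₀ * u i₁ ≢ 0#
      tᵢ₀uᵢ₁≢0 = *-nonzero (a≢0⇒t≢0 (leading-nonzero l≤n leading Fin.zero))
                           (a≢0⇒u≢0 (leading-nonzero l≤n leading (Fin.suc Fin.zero)))
    η₂δ-independent t≢0 u≢0 independent (suc (suc (suc l))) l≤n leading _ =
      ⊥-elim (three-nonzero-impossible (inject≤-≢ l≤n (λ ())) (inject≤-≢ l≤n (λ ()))
                                       (inject≤-≢ l≤n (λ ()))
                (leading-nonzero l≤n leading Fin.zero) (leading-nonzero l≤n leading (Fin.suc Fin.zero))
                (leading-nonzero l≤n leading (Fin.suc (Fin.suc Fin.zero))))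

proposition4p3 : (p s n : ℕ) → Prime p → p ≢ 2 → 1 ≤ s → 1 ≤ n →
    (L : FieldOfOrder ((p ^ s) ^ n)) →
    let open FieldOfOrder L
        open FieldTheory {p ^ s} {n} L
    in (c : Carrier) → c ≢ 0# →
       (v : Fin n → Carrier) → IsBasis v →
       (M : Mat) → InGL M →
       (l : ℕ) → (l≤n : l ≤ n) → (a : Fin n → Carrier) →
       (∀ i → toℕ i < l → InK (a i) × (a i ≢ 0#)) →
       (∀ i → l ≤ toℕ i → a i ≡ 0#) →
       (M · Hmat c v · M ᵀ) ≐ diag a →
       let δ = Πᶠ l (λ i → a (inject≤ i l≤n))
       in (InK c → η₂ δ ≡ η₂ c) × (¬ InK c → η₂ δ ≡ η₂ (- 1#))
proposition4p3 p s n pp p≢2 1≤s 1≤n L c c≢0 v basis M M∈GL l l≤n a leading trailing MHMᵀ≐diag =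
    (λ c∈K → η₂δ-proportional c∈K c≢0 (traceCoordinates-proportional v M c∈K) t≢0 l l≤n leading trailing)
  , (λ c∉K → η₂δ-independent t≢0 u≢0 (traceCoordinates-independent basis M∈GL c∉K) l l≤n leading trailing)
  where
  open FieldOfOrder L
  open FiniteField L using (1≢0)
  open Subfield pp 1≤s 1≤n L using (p≢2⇒1#+1#≢0)
  open TraceForm pp 1≤s 1≤n L
  2≢0 : 1# + 1# ≢ 0#
  2≢0 = p≢2⇒1#+1#≢0 p≢2
  open Diagonalized 2≢0 c v M a MHMᵀ≐diag
  open RankTwo pp 1≤s 1≤n L
  open Symmetrized 2≢0 t u a
         (traceCoordinates-InK (proj₁ M∈GL) 1#) (traceCoordinates-InK (proj₁ M∈GL) c) diagonal off-diagonal
  t≢0 : ¬ (∀ i → t i ≡ 0#)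
  t≢0 = traceCoordinates-nonzero basis M∈GL 1≢0
  u≢0 : ¬ (∀ i → u i ≡ 0#)
  u≢0 = traceCoordinates-nonzero basis M∈GL c≢0
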